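{- Let $k\geq 2$. For integers $0\le i<j$ put $\beta_{i,j}=jx\prod_{s=i+1}^{j-1}(sx-1)$ (an empty product equals $1$), and put $\beta_{j,j}=1$. Let $\mathcal{N}_{k,1}(n)$ be the set of $(k,1)$-noncrossing partitions of $[n]$. Then \[ \sum_{n\geq 0}\#\mathcal{N}_{k,1}(n)x^{n}=\frac{1-x+(1-x)\sum_{j=1}^{k-2}\sum_{i=0}^{j}(-1)^{i+j}x^{i}\beta_{i,j}+\sum_{i=0}^{k-1}(-1)^{i+k-1}x^{i}\beta_{i,k-1}}{1-x-x(1-x)\sum_{j=1}^{k-2}\sum_{i=0}^{j}(-1)^{i+j}i\beta_{i,j}-x\sum_{i=0}^{k-1}(-1)^{i+k-1}i\beta_{i,k-1}}. \]
   Context: A set partition of $[n]=\{1,\dots,n\}$ is identified with its canonical sequential form $\pi_1\pi_2\cdots\pi_n$: list the blocks $B_1,\dots,B_d$ in increasing order of their minimum elements and set $\pi_i=m$ iff $i\in B_m$ (the empty word is the unique partition of $[0]$). The reduced form of a word over letters $a_1<\dots<a_d$ is obtained by renaming $a_i$ as $i$. A partition $\pi$ avoids a word $\tau$ if no subsequence of $\pi$ has the same reduced form as $\tau$. A partition is $(k,1)$-noncrossing if it avoids $12\cdots k1$. -}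

module Defs where

open import Data.Nat as ℕ using (ℕ; zero; suc; _≤_; _⊔_; _<?_; _∸_)
open import Data.Integer as ℤ using (ℤ; +_; -_; _+_; _*_; _-_; _^_)
open import Data.List using (List; []; _∷_; length; map; filter; deduplicate; upTo; _++_; foldr)
open import Data.List.Relation.Binary.Sublist.Propositional using (_⊆_)
open import Data.List.Relation.Unary.Unique.Propositional using (Unique)
open import Data.List.Membership.Propositional using (_∈_)
open import Data.Product using (Σ; _×_; ∃)
open import Data.Unit using (⊤)
open import Relation.Nullary using (¬_)
open import Relation.Binary.PropositionalEquality using (_≡_)
open import Function.Bundles using (_⇔_)

-- Set partitions of [n] in canonical sequential form (restricted growth
-- words over letters 1,2,...): π₁ = 1 and each letter is at most one more
-- than the maximum of the preceding letters.

RG : ℕ → List ℕ → Set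
RG m []      = ⊤
RG m (a ∷ w) = 1 ≤ a × a ≤ suc m × RG (m ⊔ a) w

IsPartition : ℕ → List ℕ → Set
IsPartition n w = length w ≡ n × RG 0 w

reduce : List ℕ → List ℕ
reduce w = map (λ a → suc (length (deduplicate ℕ._≟_ (filter (_<? a) w)))) w

Avoids : List ℕ → List ℕ → Set
Avoids π τ = ¬ (Σ (List ℕ) λ σ → σ ⊆ π × reduce σ ≡ reduce τ)

pattern-k1 : ℕ → List ℕ
pattern-k1 k = map suc (upTo k) ++ (1 ∷ [])

Noncrossing-k1 : ℕ → ℕ → List ℕ → Set
Noncrossing-k1 k n π = IsPartition n π × Avoids π (pattern-k1 k)

HasCard : (List ℕ → Set) → ℕ → Set
HasCard P c = Σ (List (List ℕ)) λ L → Unique L × (∀ w → (w ∈ L) ⇔ P w) × length L ≡ c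

-- Polynomials with integer coefficients, as coefficient lists
-- (constant term first).

Poly : Set
Poly = List ℤ

infixl 6 _⊕_
infixl 7 _⊗_

_⊕_ : Poly → Poly → Poly
[]      ⊕ q       = q
(a ∷ p) ⊕ []      = a ∷ p
(a ∷ p) ⊕ (b ∷ q) = (a + b) ∷ (p ⊕ q)

scale : ℤ → Poly → Poly
scale c p = map (c *_) p

_⊗_ : Poly → Poly → Poly
[]      ⊗ q = []
(a ∷ p) ⊗ q = scale a q ⊕ (+ 0 ∷ (p ⊗ q))

constP : ℤ → Poly
constP c = c ∷ []

X : Poly
X = + 0 ∷ + 1 ∷ []

X^ : ℕ → Poly
X^ zero    = constP (+ 1)
X^ (suc i) = X ⊗ X^ i

negP : Poly → Poly
negP = scale (- + 1)

sumP : List Poly → Poly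
sumP = foldr _⊕_ []

prodP : List Poly → Poly
prodP = foldr _⊗_ (constP (+ 1))

-- [a, a+1, ..., b]  (empty if b < a)
range : ℕ → ℕ → List ℕ
range a b = map (a ℕ.+_) (upTo (suc b ∸ a))

coeff : Poly → ℕ → ℤ
coeff []      _       = + 0
coeff (a ∷ p) zero    = a
coeff (a ∷ p) (suc n) = coeff p n

β : ℕ → ℕ → Poly
β i j with i ℕ.≟ j
... | Relation.Nullary.yes _ = constP (+ 1)
... | Relation.Nullary.no  _ =
  scale (+ j) X ⊗ prodP (map (λ s → scale (+ s) X ⊕ constP (- + 1)) (range (suc i) (j ∸ 1)))

sgn : ℕ → ℤ
sgn n = (- + 1) ^ n

Snum : ℕ → Poly
Snum j = sumP (map (λ i → scale (sgn (i ℕ.+ j)) (X^ i ⊗ β i j)) (range 0 j))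

Sden : ℕ → Poly
Sden j = sumP (map (λ i → scale (sgn (i ℕ.+ j) * + i) (β i j)) (range 0 j))

oneMinusX : Poly
oneMinusX = constP (+ 1) ⊕ negP X

Num : ℕ → Poly
Num k = oneMinusX
      ⊕ oneMinusX ⊗ sumP (map Snum (range 1 (k ∸ 2)))
      ⊕ Snum (k ∸ 1)

Den : ℕ → Poly
Den k = oneMinusX
      ⊕ negP (X ⊗ oneMinusX ⊗ sumP (map Sden (range 1 (k ∸ 2))))
      ⊕ negP (X ⊗ Sden (k ∸ 1))

sumTo : ℕ → (ℕ → ℤ) → ℤ
sumTo zero    f = f 0
sumTo (suc n) f = sumTo n f + f (suc n)

seriesTimes : (ℕ → ℕ) → Poly → ℕ → ℤ
seriesTimes a D n = sumTo n (λ m → + a m * coeff D (n ∸ m))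

-- A restricted growth word contains 1 2 ⋯ m as a subsequence of any prefix with maximum m, so it
-- contains 1 2 ⋯ k 1 exactly when some letter lies at least k − 1 below the maximum of the letters
-- before it. Let G_m count the words avoiding this that continue a prefix with maximum m. A next
-- letter repeats one of min(m, k − 1) allowed old letters or opens a new block, so
-- G_m (1 − m x) = 1 + x G_{m+1} for m ≤ k − 1, and G_k = G_{k−1}. Eliminating G_1, …, G_{k−1} gives
--   G_0 · (1 − k x) ∏_{s=1}^{k−2} (1 − s x) = (1 − k x) R_{k−2} + x^{k−1},
--   R_J = Σ_{d=0}^{J} x^d ∏_{s=d+1}^{J} (1 − s x).
-- Since (−1)^{i+j} β_{i,j} = −j x ∏_{s=i+1}^{j−1} (1 − s x) for i < j, the inner sums over i of the
-- statement telescope, and its numerator and denominator are exactly these two polynomials.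

module Submission where

open import Defs
open import Data.Nat using (ℕ; _≥_)
open import Data.Product using (Σ; _×_)
open import Relation.Binary.PropositionalEquality using (_≡_)

module PowerSeries where

  open import Data.Nat as ℕ using (ℕ; zero; suc; _≤_; _∸_; z≤n)
  import Data.Nat.Properties as ℕ
  open import Data.Integer as ℤ using (ℤ; +_; _+_; _*_)
  import Data.Integer.Properties as ℤ
  open import Data.Integer.Solver using (module +-*-Solver)
  open import Data.List using ([]; _∷_)
  open import Relation.Binary.PropositionalEquality
  open +-*-Solver using (solve; _:+_; _:*_; _:=_)

  Series : Set
  Series = ℕ → ℤ

  infixl 7 _⊛_

  _⊛_ : Series → Poly → Series
  (f ⊛ p) n = sumTo n (λ m → f m * coeff p (n ∸ m))

  shift : Series → Series
  shift f zero    = + 0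
  shift f (suc n) = f n

  shift-cong : ∀ {f g} → f ≗ g → shift f ≗ shift g
  shift-cong eq zero    = refl
  shift-cong eq (suc n) = eq n

  sumTo-cong : ∀ n {f g : ℕ → ℤ} → (∀ m → m ≤ n → f m ≡ g m) → sumTo n f ≡ sumTo n g
  sumTo-cong zero    eq = eq 0 z≤n
  sumTo-cong (suc n) eq =
    cong₂ _+_ (sumTo-cong n (λ m m≤n → eq m (ℕ.m≤n⇒m≤1+n m≤n))) (eq (suc n) ℕ.≤-refl)

  sumTo-distrib-+ : ∀ n (f g : ℕ → ℤ) → sumTo n (λ m → f m + g m) ≡ sumTo n f + sumTo n g
  sumTo-distrib-+ zero    f g = refl
  sumTo-distrib-+ (suc n) f g rewrite sumTo-distrib-+ n f g =
    solve 4 (λ a b c d → (a :+ b) :+ (c :+ d) := (a :+ c) :+ (b :+ d)) refl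
      (sumTo n f) (sumTo n g) (f (suc n)) (g (suc n))

  sumTo-*ˡ : ∀ n c (f : ℕ → ℤ) → sumTo n (λ m → c * f m) ≡ c * sumTo n f
  sumTo-*ˡ zero    c f = refl
  sumTo-*ˡ (suc n) c f rewrite sumTo-*ˡ n c f = sym (ℤ.*-distribˡ-+ c (sumTo n f) (f (suc n)))

  sumTo-zero : ∀ n (f : ℕ → ℤ) → (∀ m → f m ≡ + 0) → sumTo n f ≡ + 0
  sumTo-zero zero    f f≡0 = f≡0 0
  sumTo-zero (suc n) f f≡0 rewrite sumTo-zero n f f≡0 | f≡0 (suc n) = refl

  sumTo-unfoldˡ : ∀ n (f : ℕ → ℤ) → sumTo (suc n) f ≡ f 0 + sumTo n (λ m → f (suc m))
  sumTo-unfoldˡ zero    f = refl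
  sumTo-unfoldˡ (suc n) f rewrite sumTo-unfoldˡ n f = ℤ.+-assoc (f 0) _ _

  coeff-⊕ : ∀ p q i → coeff (p ⊕ q) i ≡ coeff p i + coeff q i
  coeff-⊕ []      q       i       = sym (ℤ.+-identityˡ _)
  coeff-⊕ (a ∷ p) []      i       = sym (ℤ.+-identityʳ _)
  coeff-⊕ (a ∷ p) (b ∷ q) zero    = refl
  coeff-⊕ (a ∷ p) (b ∷ q) (suc i) = coeff-⊕ p q i

  coeff-scale : ∀ c p i → coeff (scale c p) i ≡ c * coeff p i
  coeff-scale c []      i       = sym (ℤ.*-zeroʳ c)
  coeff-scale c (a ∷ p) zero    = refl
  coeff-scale c (a ∷ p) (suc i) = coeff-scale c p i

  ⊛-congˡ : ∀ {f g} p → f ≗ g → f ⊛ p ≗ g ⊛ p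
  ⊛-congˡ p f≗g n = sumTo-cong n (λ m _ → cong (_* coeff p (n ∸ m)) (f≗g m))

  ⊛-zeroˡ : ∀ f p → (∀ m → f m ≡ + 0) → ∀ n → (f ⊛ p) n ≡ + 0
  ⊛-zeroˡ f p f≡0 n = sumTo-zero n _ (λ m → cong (_* coeff p (n ∸ m)) (f≡0 m))

  ⊛-zeroʳ : ∀ f n → (f ⊛ []) n ≡ + 0
  ⊛-zeroʳ f n = sumTo-zero n _ (λ m → ℤ.*-zeroʳ (f m))

  ⊛-⊕ : ∀ f p q n → (f ⊛ (p ⊕ q)) n ≡ (f ⊛ p) n + (f ⊛ q) n
  ⊛-⊕ f p q n = trans
    (sumTo-cong n (λ m _ → trans (cong (f m *_) (coeff-⊕ p q (n ∸ m))) (ℤ.*-distribˡ-+ (f m) _ _)))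
    (sumTo-distrib-+ n _ _)

  ⊛-scale : ∀ f c p n → (f ⊛ scale c p) n ≡ c * (f ⊛ p) n
  ⊛-scale f c p n = trans
    (sumTo-cong n (λ m _ → trans (cong (f m *_) (coeff-scale c p (n ∸ m)))
      (solve 3 (λ a b d → a :* (b :* d) := b :* (a :* d)) refl (f m) c _)))
    (sumTo-*ˡ n c _)

  ⊛-∷ : ∀ f a p n → (f ⊛ (a ∷ p)) n ≡ a * f n + shift (f ⊛ p) n
  ⊛-∷ f a p zero    = trans (ℤ.*-comm (f 0) a) (sym (ℤ.+-identityʳ _))
  ⊛-∷ f a p (suc n) = begin
    sumTo n (λ m → f m * coeff (a ∷ p) (suc n ∸ m)) + f (suc n) * coeff (a ∷ p) (suc n ∸ suc n)
      ≡⟨ cong₂ _+_ (sumTo-cong n (λ m m≤n → cong (λ i → f m * coeff (a ∷ p) i) (ℕ.+-∸-assoc 1 m≤n)))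
                   (cong (λ i → f (suc n) * coeff (a ∷ p) i) (ℕ.n∸n≡0 n)) ⟩
    (f ⊛ p) n + f (suc n) * a
      ≡⟨ ℤ.+-comm ((f ⊛ p) n) (f (suc n) * a) ⟩
    f (suc n) * a + (f ⊛ p) n
      ≡⟨ cong (_+ (f ⊛ p) n) (ℤ.*-comm (f (suc n)) a) ⟩
    a * f (suc n) + (f ⊛ p) n ∎
    where open ≡-Reasoning

  +-⊛ : ∀ f g p n → ((λ m → f m + g m) ⊛ p) n ≡ (f ⊛ p) n + (g ⊛ p) n
  +-⊛ f g p n = trans (sumTo-cong n (λ m _ → ℤ.*-distribʳ-+ (coeff p (n ∸ m)) (f m) (g m)))
                      (sumTo-distrib-+ n _ _)

  *-⊛ : ∀ c f p n → ((λ m → c * f m) ⊛ p) n ≡ c * (f ⊛ p) n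
  *-⊛ c f p n = trans (sumTo-cong n (λ m _ → ℤ.*-assoc c (f m) _)) (sumTo-*ˡ n c _)

  shift-⊛ : ∀ f p → shift f ⊛ p ≗ shift (f ⊛ p)
  shift-⊛ f p zero    = refl
  shift-⊛ f p (suc n) = trans (sumTo-unfoldˡ n _) (ℤ.+-identityˡ _)

  ⊛-∷-⊛ : ∀ f a p q n → ((f ⊛ (a ∷ p)) ⊛ q) n ≡ a * (f ⊛ q) n + shift ((f ⊛ p) ⊛ q) n
  ⊛-∷-⊛ f a p q n = begin
    ((f ⊛ (a ∷ p)) ⊛ q) n                     ≡⟨ ⊛-congˡ q (⊛-∷ f a p) n ⟩
    ((λ m → a * f m + shift (f ⊛ p) m) ⊛ q) n ≡⟨ +-⊛ (λ m → a * f m) (shift (f ⊛ p)) q n ⟩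
    ((λ m → a * f m) ⊛ q) n + (shift (f ⊛ p) ⊛ q) n
                                              ≡⟨ cong (_+ (shift (f ⊛ p) ⊛ q) n) (*-⊛ a f q n) ⟩
    a * (f ⊛ q) n + (shift (f ⊛ p) ⊛ q) n     ≡⟨ cong (λ z → a * (f ⊛ q) n + z) (shift-⊛ (f ⊛ p) q n) ⟩
    a * (f ⊛ q) n + shift ((f ⊛ p) ⊛ q) n     ∎
    where open ≡-Reasoning

  ⊛-⊗ : ∀ f p q → f ⊛ (p ⊗ q) ≗ (f ⊛ p) ⊛ q
  ⊛-⊗ f []      q n = trans (⊛-zeroʳ f n) (sym (⊛-zeroˡ _ q (⊛-zeroʳ f) n))
  ⊛-⊗ f (a ∷ p) q n = begin
    (f ⊛ (scale a q ⊕ (+ 0 ∷ p ⊗ q))) n           ≡⟨ ⊛-⊕ f (scale a q) _ n ⟩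
    (f ⊛ scale a q) n + (f ⊛ (+ 0 ∷ p ⊗ q)) n     ≡⟨ cong₂ _+_ (⊛-scale f a q n) (⊛-∷ f (+ 0) (p ⊗ q) n) ⟩
    a * (f ⊛ q) n + (+ 0 + shift (f ⊛ (p ⊗ q)) n) ≡⟨ cong (_+_ a⋯) (ℤ.+-identityˡ _) ⟩
    a * (f ⊛ q) n + shift (f ⊛ (p ⊗ q)) n         ≡⟨ cong (_+_ a⋯) (shift-cong (⊛-⊗ f p q) n) ⟩
    a * (f ⊛ q) n + shift ((f ⊛ p) ⊛ q) n         ≡⟨ ⊛-∷-⊛ f a p q n ⟨
    ((f ⊛ (a ∷ p)) ⊛ q) n                         ∎
    where
    open ≡-Reasoning
    a⋯ = a * (f ⊛ q) n

  ⊛-⊛-comm : ∀ f p q → (f ⊛ p) ⊛ q ≗ (f ⊛ q) ⊛ p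
  ⊛-⊛-comm f p []      n = trans (⊛-zeroʳ (f ⊛ p) n) (sym (⊛-zeroˡ _ p (⊛-zeroʳ f) n))
  ⊛-⊛-comm f p (b ∷ q) n = begin
    ((f ⊛ p) ⊛ (b ∷ q)) n                 ≡⟨ ⊛-∷ (f ⊛ p) b q n ⟩
    b * (f ⊛ p) n + shift ((f ⊛ p) ⊛ q) n ≡⟨ cong (λ z → b * (f ⊛ p) n + z) (shift-cong (⊛-⊛-comm f p q) n) ⟩
    b * (f ⊛ p) n + shift ((f ⊛ q) ⊛ p) n ≡⟨ ⊛-∷-⊛ f b q p n ⟨
    ((f ⊛ (b ∷ q)) ⊛ p) n                 ∎
    where open ≡-Reasoning

module PolynomialRing where

  open PowerSeries
  open import Data.Nat as ℕ using (zero; suc; _∸_)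
  open import Data.Integer as ℤ using (ℤ; +_; -_; _+_; _*_)
  import Data.Integer.Properties as ℤ
  open import Data.Integer.Solver using (module +-*-Solver)
  open import Data.List using ([])
  open import Data.Maybe using (Maybe; just; nothing)
  open import Data.Product using (_,_)
  open import Relation.Binary.PropositionalEquality
  open import Relation.Nullary using (yes; no)
  open import Algebra.Solver.Ring.AlmostCommutativeRing
  import Algebra.Solver.Ring

  -- Polynomials are compared by how they multiply series: trailing zeros no longer matter,
  -- and every ring law reduces to a manipulation of finite sums in ℤ.
  infix 4 _≈_
  record _≈_ (p q : Poly) : Set where
    constructor mk≈
    field ⊛-≗ : ∀ f → f ⊛ p ≗ f ⊛ q
  open _≈_ public

  ≈-refl : ∀ {p} → p ≈ p
  ≈-refl = mk≈ (λ f n → refl)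

  ≈-sym : ∀ {p q} → p ≈ q → q ≈ p
  ≈-sym p≈q = mk≈ (λ f n → sym (⊛-≗ p≈q f n))

  ≈-trans : ∀ {p q r} → p ≈ q → q ≈ r → p ≈ r
  ≈-trans p≈q q≈r = mk≈ (λ f n → trans (⊛-≗ p≈q f n) (⊛-≗ q≈r f n))

  ≡⇒≈ : ∀ {p q} → p ≡ q → p ≈ q
  ≡⇒≈ refl = ≈-refl

  ⊛-constP : ∀ f c n → (f ⊛ constP c) n ≡ c * f n
  ⊛-constP f c zero    = trans (⊛-∷ f c [] 0) (ℤ.+-identityʳ _)
  ⊛-constP f c (suc n) = trans (⊛-∷ f c [] (suc n))
    (trans (cong (λ z → c * f (suc n) + z) (⊛-zeroʳ f n)) (ℤ.+-identityʳ _))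

  ⊛-negP : ∀ f p n → (f ⊛ negP p) n ≡ - (f ⊛ p) n
  ⊛-negP f p n = trans (⊛-scale f (- + 1) p n) (ℤ.-1*i≡-i _)

  ⊕-cong : ∀ {p p′ q q′} → p ≈ p′ → q ≈ q′ → p ⊕ q ≈ p′ ⊕ q′
  ⊕-cong {p} {p′} {q} {q′} p≈p′ q≈q′ = mk≈ λ f n →
    trans (⊛-⊕ f p q n) (trans (cong₂ _+_ (⊛-≗ p≈p′ f n) (⊛-≗ q≈q′ f n)) (sym (⊛-⊕ f p′ q′ n)))

  ⊗-cong : ∀ {p p′ q q′} → p ≈ p′ → q ≈ q′ → p ⊗ q ≈ p′ ⊗ q′
  ⊗-cong {p} {p′} {q} {q′} p≈p′ q≈q′ = mk≈ λ f n →
    trans (⊛-⊗ f p q n) (trans (⊛-congˡ q (⊛-≗ p≈p′ f) n)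
      (trans (⊛-≗ q≈q′ (f ⊛ p′) n) (sym (⊛-⊗ f p′ q′ n))))

  negP-cong : ∀ {p q} → p ≈ q → negP p ≈ negP q
  negP-cong {p} {q} p≈q = mk≈ λ f n →
    trans (⊛-negP f p n) (trans (cong -_ (⊛-≗ p≈q f n)) (sym (⊛-negP f q n)))

  scale-cong : ∀ c {p q} → p ≈ q → scale c p ≈ scale c q
  scale-cong c {p} {q} p≈q = mk≈ λ f n →
    trans (⊛-scale f c p n) (trans (cong (c *_) (⊛-≗ p≈q f n)) (sym (⊛-scale f c q n)))

  ⊕-assoc : ∀ p q r → (p ⊕ q) ⊕ r ≈ p ⊕ (q ⊕ r)
  ⊕-assoc p q r = mk≈ λ f n → begin
    (f ⊛ (p ⊕ q ⊕ r)) n                   ≡⟨ ⊛-⊕ f (p ⊕ q) r n ⟩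
    (f ⊛ (p ⊕ q)) n + (f ⊛ r) n           ≡⟨ cong (_+ (f ⊛ r) n) (⊛-⊕ f p q n) ⟩
    (f ⊛ p) n + (f ⊛ q) n + (f ⊛ r) n     ≡⟨ ℤ.+-assoc ((f ⊛ p) n) _ _ ⟩
    (f ⊛ p) n + ((f ⊛ q) n + (f ⊛ r) n)   ≡⟨ cong (λ z → (f ⊛ p) n + z) (⊛-⊕ f q r n) ⟨
    (f ⊛ p) n + (f ⊛ (q ⊕ r)) n           ≡⟨ ⊛-⊕ f p (q ⊕ r) n ⟨
    (f ⊛ (p ⊕ (q ⊕ r))) n                 ∎
    where open ≡-Reasoning

  ⊕-comm : ∀ p q → p ⊕ q ≈ q ⊕ p
  ⊕-comm p q = mk≈ λ f n →
    trans (⊛-⊕ f p q n) (trans (ℤ.+-comm ((f ⊛ p) n) _) (sym (⊛-⊕ f q p n)))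

  ⊕-identityʳ : ∀ p → p ⊕ [] ≈ p
  ⊕-identityʳ p = mk≈ λ f n →
    trans (⊛-⊕ f p [] n) (trans (cong (λ z → (f ⊛ p) n + z) (⊛-zeroʳ f n)) (ℤ.+-identityʳ _))

  ⊗-assoc : ∀ p q r → (p ⊗ q) ⊗ r ≈ p ⊗ (q ⊗ r)
  ⊗-assoc p q r = mk≈ λ f n →
    trans (⊛-⊗ f (p ⊗ q) r n) (trans (⊛-congˡ r (⊛-⊗ f p q) n)
      (sym (trans (⊛-⊗ f p (q ⊗ r) n) (⊛-⊗ (f ⊛ p) q r n))))

  ⊗-comm : ∀ p q → p ⊗ q ≈ q ⊗ p
  ⊗-comm p q = mk≈ λ f n →
    trans (⊛-⊗ f p q n) (trans (⊛-⊛-comm f p q n) (sym (⊛-⊗ f q p n)))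

  ⊗-identityˡ : ∀ p → constP (+ 1) ⊗ p ≈ p
  ⊗-identityˡ p = mk≈ λ f n →
    trans (⊛-⊗ f (constP (+ 1)) p n)
      (⊛-congˡ p (λ m → trans (⊛-constP f (+ 1) m) (ℤ.*-identityˡ _)) n)

  ⊗-identityʳ : ∀ p → p ⊗ constP (+ 1) ≈ p
  ⊗-identityʳ p = ≈-trans (⊗-comm p _) (⊗-identityˡ p)

  ⊗-distribʳ : ∀ p q r → (q ⊕ r) ⊗ p ≈ q ⊗ p ⊕ r ⊗ p
  ⊗-distribʳ p q r = mk≈ λ f n → begin
    (f ⊛ ((q ⊕ r) ⊗ p)) n                        ≡⟨ ⊛-⊗ f (q ⊕ r) p n ⟩
    ((f ⊛ (q ⊕ r)) ⊛ p) n                        ≡⟨ ⊛-congˡ p (⊛-⊕ f q r) n ⟩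
    ((λ m → (f ⊛ q) m + (f ⊛ r) m) ⊛ p) n        ≡⟨ +-⊛ (f ⊛ q) (f ⊛ r) p n ⟩
    ((f ⊛ q) ⊛ p) n + ((f ⊛ r) ⊛ p) n            ≡⟨ cong₂ _+_ (⊛-⊗ f q p n) (⊛-⊗ f r p n) ⟨
    (f ⊛ (q ⊗ p)) n + (f ⊛ (r ⊗ p)) n            ≡⟨ ⊛-⊕ f (q ⊗ p) (r ⊗ p) n ⟨
    (f ⊛ (q ⊗ p ⊕ r ⊗ p)) n                               ∎
    where open ≡-Reasoning

  ⊗-distribˡ : ∀ p q r → p ⊗ (q ⊕ r) ≈ p ⊗ q ⊕ p ⊗ r
  ⊗-distribˡ p q r =
    ≈-trans (⊗-comm p _) (≈-trans (⊗-distribʳ p q r) (⊕-cong (⊗-comm q p) (⊗-comm r p)))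

  ⊗-zeroʳ : ∀ p → p ⊗ [] ≈ []
  ⊗-zeroʳ p = ⊗-comm p []

  negP-distribˡ-⊗ : ∀ p q → negP p ⊗ q ≈ negP (p ⊗ q)
  negP-distribˡ-⊗ p q = mk≈ λ f n → begin
    (f ⊛ (negP p ⊗ q)) n                       ≡⟨ ⊛-⊗ f (negP p) q n ⟩
    ((f ⊛ negP p) ⊛ q) n                       ≡⟨ ⊛-congˡ q (⊛-scale f (- + 1) p) n ⟩
    ((λ m → - + 1 * (f ⊛ p) m) ⊛ q) n          ≡⟨ *-⊛ (- + 1) (f ⊛ p) q n ⟩
    - + 1 * ((f ⊛ p) ⊛ q) n                    ≡⟨ cong (- + 1 *_) (⊛-⊗ f p q n) ⟨
    - + 1 * (f ⊛ (p ⊗ q)) n                    ≡⟨ ⊛-scale f (- + 1) (p ⊗ q) n ⟨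
    (f ⊛ negP (p ⊗ q)) n                       ∎
    where open ≡-Reasoning

  negP-distrib-⊕ : ∀ p q → negP p ⊕ negP q ≈ negP (p ⊕ q)
  negP-distrib-⊕ p q = mk≈ λ f n → begin
    (f ⊛ (negP p ⊕ negP q)) n       ≡⟨ ⊛-⊕ f (negP p) (negP q) n ⟩
    (f ⊛ negP p) n + (f ⊛ negP q) n ≡⟨ cong₂ _+_ (⊛-negP f p n) (⊛-negP f q n) ⟩
    - (f ⊛ p) n + - (f ⊛ q) n       ≡⟨ ℤ.neg-distrib-+ ((f ⊛ p) n) _ ⟨
    - ((f ⊛ p) n + (f ⊛ q) n)       ≡⟨ cong -_ (⊛-⊕ f p q n) ⟨
    - (f ⊛ (p ⊕ q)) n               ≡⟨ ⊛-negP f (p ⊕ q) n ⟨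
    (f ⊛ negP (p ⊕ q)) n            ∎
    where open ≡-Reasoning

  Poly-isAlmostCommutativeRing : IsAlmostCommutativeRing _≈_ _⊕_ _⊗_ negP [] (constP (+ 1))
  Poly-isAlmostCommutativeRing = record
    { isCommutativeSemiring = record
      { isSemiring = record
        { isSemiringWithoutAnnihilatingZero = record
          { +-isCommutativeMonoid = record
            { isMonoid = record
              { isSemigroup = record
                { isMagma = record
                  { isEquivalence = record { refl = ≈-refl ; sym = ≈-sym ; trans = ≈-trans }
                  ; ∙-cong = ⊕-cong }
                ; assoc = ⊕-assoc }
              ; identity = (λ p → ≈-refl) , ⊕-identityʳ }
            ; comm = ⊕-comm }
          ; *-cong = ⊗-cong
          ; *-assoc = ⊗-assoc
          ; *-identity = ⊗-identityˡ , ⊗-identityʳ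
          ; distrib = ⊗-distribˡ , ⊗-distribʳ }
        ; zero = (λ p → ≈-refl) , ⊗-zeroʳ }
      ; *-comm = ⊗-comm }
    ; -‿cong = negP-cong
    ; -‿*-distribˡ = negP-distribˡ-⊗
    ; -‿+-comm = negP-distrib-⊕ }

  Poly-almostCommutativeRing : AlmostCommutativeRing _ _
  Poly-almostCommutativeRing = record { isAlmostCommutativeRing = Poly-isAlmostCommutativeRing }

  constP-* : ∀ a b → constP (a * b) ≈ constP a ⊗ constP b
  constP-* a b = mk≈ λ f n → begin
    (f ⊛ constP (a * b)) n             ≡⟨ ⊛-constP f (a * b) n ⟩
    a * b * f n                        ≡⟨ +-*-Solver.solve 3 (λ a b x → a :* b :* x := b :* (a :* x)) refl a b (f n) ⟩
    b * (a * f n)                      ≡⟨ cong (b *_) (⊛-constP f a n) ⟨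
    b * (f ⊛ constP a) n               ≡⟨ ⊛-constP (f ⊛ constP a) b n ⟨
    ((f ⊛ constP a) ⊛ constP b) n      ≡⟨ ⊛-⊗ f (constP a) (constP b) n ⟨
    (f ⊛ (constP a ⊗ constP b)) n      ∎
    where
    open ≡-Reasoning
    open +-*-Solver using (_:*_; _:=_)

  constP-neg : ∀ a → constP (- a) ≈ negP (constP a)
  constP-neg a = mk≈ λ f n →
    trans (⊛-constP f (- a) n) (trans (sym (ℤ.neg-distribˡ-* a (f n)))
      (sym (trans (⊛-negP f (constP a) n) (cong -_ (⊛-constP f a n)))))

  constP-0 : constP (+ 0) ≈ []
  constP-0 = mk≈ λ f n → trans (⊛-constP f (+ 0) n) (sym (⊛-zeroʳ f n))

  constP-homomorphism : ℤ.+-*-rawRing -Raw-AlmostCommutative⟶ Poly-almostCommutativeRing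
  constP-homomorphism = record
    { ⟦_⟧ = constP
    ; +-homo = λ a b → ≈-refl
    ; *-homo = constP-*
    ; -‿homo = constP-neg
    ; 0-homo = constP-0
    ; 1-homo = ≈-refl }

  constP-≟ : ∀ a b → Maybe (constP a ≈ constP b)
  constP-≟ a b with a ℤ.≟ b
  ... | yes refl = just ≈-refl
  ... | no _     = nothing

  module PolySolver =
    Algebra.Solver.Ring ℤ.+-*-rawRing Poly-almostCommutativeRing constP-homomorphism constP-≟

  scale≈constP-⊗ : ∀ c p → scale c p ≈ constP c ⊗ p
  scale≈constP-⊗ c p = mk≈ λ f n → begin
    (f ⊛ scale c p) n              ≡⟨ ⊛-scale f c p n ⟩
    c * (f ⊛ p) n                  ≡⟨ *-⊛ c f p n ⟨
    ((λ m → c * f m) ⊛ p) n        ≡⟨ ⊛-congˡ p (λ m → sym (⊛-constP f c m)) n ⟩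
    ((f ⊛ constP c) ⊛ p) n         ≡⟨ ⊛-⊗ f (constP c) p n ⟨
    (f ⊛ (constP c ⊗ p)) n         ∎
    where open ≡-Reasoning

  δ₀ : Series
  δ₀ zero    = + 1
  δ₀ (suc n) = + 0

  δ₀-⊛ : ∀ p → δ₀ ⊛ p ≗ coeff p
  δ₀-⊛ p zero    = ℤ.*-identityˡ _
  δ₀-⊛ p (suc n) = begin
    (δ₀ ⊛ p) (suc n)
      ≡⟨ sumTo-unfoldˡ n _ ⟩
    + 1 * coeff p (suc n) + sumTo n (λ m → + 0 * coeff p (n ∸ m))
      ≡⟨ cong₂ _+_ (ℤ.*-identityˡ (coeff p (suc n))) (sumTo-zero n _ (λ m → refl)) ⟩
    coeff p (suc n) + + 0
      ≡⟨ ℤ.+-identityʳ _ ⟩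
    coeff p (suc n) ∎
    where open ≡-Reasoning

  coeff-cong : ∀ {p q} → p ≈ q → coeff p ≗ coeff q
  coeff-cong {p} {q} p≈q n = trans (sym (δ₀-⊛ p n)) (trans (⊛-≗ p≈q δ₀ n) (δ₀-⊛ q n))

module Ranges where

  open import Data.Nat using (ℕ; suc; _≤_; _<_; _∸_; _+_; s≤s)
  import Data.Nat.Properties as ℕ
  open import Data.List using (List; []; _∷_; map; _++_; upTo; applyUpTo; length; [_])
  import Data.List.Properties as List
  open import Data.List.Membership.Propositional using (_∈_)
  open import Data.List.Membership.Propositional.Properties using (∈-map⁺; ∈-map⁻; ∈-upTo⁺; ∈-upTo⁻)
  open import Data.List.Relation.Unary.Unique.Propositional using (Unique)
  import Data.List.Relation.Unary.Unique.Propositional.Properties as Unique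
  open import Data.Product using (_×_; _,_)
  open import Function using (id)
  open import Relation.Binary.PropositionalEquality hiding ([_])

  range-∷ : ∀ a b → a ≤ b → range a b ≡ a ∷ range (suc a) b
  range-∷ a b a≤b rewrite ℕ.+-∸-assoc 1 a≤b = cong₂ _∷_ (ℕ.+-identityʳ a) (begin
    map (a +_) (applyUpTo suc (b ∸ a))     ≡⟨ cong (map (a +_)) (List.map-upTo suc (b ∸ a)) ⟨
    map (a +_) (map suc (upTo (b ∸ a)))    ≡⟨ List.map-∘ (upTo (b ∸ a)) ⟨
    map (λ i → a + suc i) (upTo (b ∸ a))   ≡⟨ List.map-cong (ℕ.+-suc a) (upTo (b ∸ a)) ⟩
    range (suc a) b                        ∎)
    where open ≡-Reasoning

  range-∷ʳ : ∀ a b → a ≤ suc b → range a (suc b) ≡ range a b ++ [ suc b ]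
  range-∷ʳ a b a≤1+b rewrite ℕ.+-∸-assoc 1 a≤1+b = begin
    map (a +_) (upTo (suc (suc b ∸ a)))          ≡⟨ cong (map (a +_)) (List.upTo-∷ʳ (suc b ∸ a)) ⟨
    map (a +_) (upTo (suc b ∸ a) ++ [ suc b ∸ a ]) ≡⟨ List.map-++ (a +_) (upTo (suc b ∸ a)) _ ⟩
    range a b ++ [ a + (suc b ∸ a) ]             ≡⟨ cong (λ z → range a b ++ [ z ]) (ℕ.m+[n∸m]≡n a≤1+b) ⟩
    range a b ++ [ suc b ]                       ∎
    where open ≡-Reasoning

  range-empty : ∀ a b → b < a → range a b ≡ []
  range-empty a b b<a rewrite ℕ.m≤n⇒m∸n≡0 b<a = refl

  range-singleton : ∀ a → range a a ≡ [ a ]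
  range-singleton a = trans (range-∷ a a ℕ.≤-refl) (cong (a ∷_) (range-empty (suc a) a (ℕ.n<1+n a)))

  length-range : ∀ a b → length (range a b) ≡ suc b ∸ a
  length-range a b = trans (List.length-map (a +_) (upTo (suc b ∸ a))) (List.length-upTo _)

  ∈-range⁻ : ∀ {a b x} → x ∈ range a b → a ≤ x × x ≤ b
  ∈-range⁻ {a} {b} x∈ with ∈-map⁻ (a +_) x∈
  ... | i , i∈ , refl =
    ℕ.m≤m+n a i , ℕ.≤-pred (subst (_≤ suc b) (trans (ℕ.+-comm (suc i) a) (ℕ.+-suc a i)) 1+i+a≤1+b)
    where
    i<1+b∸a : i < suc b ∸ a
    i<1+b∸a = ∈-upTo⁻ i∈
    a≤1+b : a ≤ suc b
    a≤1+b = ℕ.<⇒≤ (ℕ.m∸n≢0⇒n<m (λ eq → ℕ.n≮0 (subst (i <_) eq i<1+b∸a)))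
    1+i+a≤1+b : suc i + a ≤ suc b
    1+i+a≤1+b = ℕ.m≤o∸n⇒m+n≤o (suc i) a≤1+b i<1+b∸a

  ∈-range⁺ : ∀ {a b x} → a ≤ x → x ≤ b → x ∈ range a b
  ∈-range⁺ {a} {b} a≤x x≤b = subst (_∈ range a b) (ℕ.m+[n∸m]≡n a≤x)
    (∈-map⁺ (a +_) (∈-upTo⁺ (ℕ.∸-monoˡ-< (s≤s x≤b) a≤x)))

  range-unique : ∀ a b → Unique (range a b)
  range-unique a b = Unique.map⁺ (ℕ.+-cancelˡ-≡ a _ _)
    (Unique.applyUpTo⁺₁ id (suc b ∸ a) (λ i<j _ i≡j → ℕ.<-irrefl i≡j i<j))

module Signs where

  open import Data.Nat as ℕ using (ℕ; suc)
  import Data.Nat.Properties as ℕ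
  open import Data.Integer using (+_; -_; _*_)
  import Data.Integer.Properties as ℤ
  open import Data.Integer.Solver using (module +-*-Solver)
  open import Relation.Binary.PropositionalEquality
  open +-*-Solver using (solve; _:*_; _:=_; con)

  sgn-+ : ∀ m n → sgn (m ℕ.+ n) ≡ sgn m * sgn n
  sgn-+ = ℤ.^-distribˡ-+-* (- + 1)

  sgn-n+n : ∀ n → sgn (n ℕ.+ n) ≡ + 1
  sgn-n+n n = trans (cong (λ m → sgn (n ℕ.+ m)) (sym (ℕ.+-identityʳ n)))
    (trans (sym (ℤ.^-*-assoc (- + 1) 2 n)) (ℤ.^-zeroˡ n))

  sgn-*-sgn : ∀ n → sgn n * sgn n ≡ + 1
  sgn-*-sgn n = trans (sym (sgn-+ n n)) (sgn-n+n n)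

  sgn-i+1+i+t : ∀ i t → sgn (i ℕ.+ suc (i ℕ.+ t)) * sgn t ≡ - + 1
  sgn-i+1+i+t i t = begin
    sgn (i ℕ.+ suc (i ℕ.+ t)) * sgn t
      ≡⟨ cong (λ m → sgn m * sgn t) (trans (ℕ.+-suc i (i ℕ.+ t)) (cong suc (sym (ℕ.+-assoc i i t)))) ⟩
    - + 1 * sgn (i ℕ.+ i ℕ.+ t) * sgn t
      ≡⟨ cong (λ s → - + 1 * s * sgn t) (trans (sgn-+ (i ℕ.+ i) t) (cong (_* sgn t) (sgn-n+n i))) ⟩
    - + 1 * (+ 1 * sgn t) * sgn t
      ≡⟨ solve 1 (λ s → con (- + 1) :* (con (+ 1) :* s) :* s := con (- + 1) :* (s :* s)) refl (sgn t) ⟩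
    - + 1 * (sgn t * sgn t)
      ≡⟨ cong (- + 1 *_) (sgn-*-sgn t) ⟩
    - + 1 ∎
    where open ≡-Reasoning

module ClosedForms where

  open PowerSeries
  open PolynomialRing
  open Ranges
  open Signs
  open import Data.Nat as ℕ using (ℕ; zero; suc; _≤_; _∸_; z≤n; s≤s)
  import Data.Nat.Properties as ℕ
  open import Data.Integer as ℤ using (ℤ; +_; -_)
  import Data.Integer.Properties as ℤ
  open import Data.List using (List; []; _∷_; map; _++_; length; [_])
  import Data.List.Properties as List
  open import Data.List.Membership.Propositional using (_∈_)
  open import Data.List.Relation.Unary.All as All using (All)
  open import Data.Product using (proj₂)
  open import Relation.Binary.PropositionalEquality as ≡ using (_≡_; refl; cong; cong₂)
  open import Relation.Nullary using (yes; no; ¬_)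
  open import Data.Empty using (⊥-elim)
  open import Algebra.Solver.Ring.AlmostCommutativeRing using (AlmostCommutativeRing)
  open import Relation.Binary.Reasoning.Setoid (AlmostCommutativeRing.setoid Poly-almostCommutativeRing)
  open PolySolver using (solve; _:+_; _:*_; :-_; _:-_; _:=_; con)

  factor : ℕ → Poly
  factor c = constP (+ 1) ⊕ negP (constP (+ c) ⊗ X)

  factors : ℕ → ℕ → Poly
  factors a b = prodP (map factor (range a b))

  tailSum : ℕ → ℕ → Poly
  tailSum a J = sumP (map (λ d → X^ d ⊗ factors (suc d) J) (range a J))

  sumP-++ : ∀ ps qs → sumP (ps ++ qs) ≈ sumP ps ⊕ sumP qs
  sumP-++ []       qs = ≈-refl
  sumP-++ (p ∷ ps) qs = ≈-trans (⊕-cong (≈-refl {p}) (sumP-++ ps qs)) (≈-sym (⊕-assoc p (sumP ps) (sumP qs)))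

  prodP-++ : ∀ ps qs → prodP (ps ++ qs) ≈ prodP ps ⊗ prodP qs
  prodP-++ []       qs = ≈-sym (⊗-identityˡ (prodP qs))
  prodP-++ (p ∷ ps) qs = ≈-trans (⊗-cong (≈-refl {p}) (prodP-++ ps qs)) (≈-sym (⊗-assoc p (prodP ps) (prodP qs)))

  sumP-map-cong : ∀ {A : Set} {g h : A → Poly} {xs} → All (λ x → g x ≈ h x) xs → sumP (map g xs) ≈ sumP (map h xs)
  sumP-map-cong All.[]           = ≈-refl
  sumP-map-cong (g≈h All.∷ g≈hs) = ⊕-cong g≈h (sumP-map-cong g≈hs)

  sumP-map-⊗ : ∀ {A : Set} (g : A → Poly) xs q → sumP (map g xs) ⊗ q ≈ sumP (map (λ x → g x ⊗ q) xs)
  sumP-map-⊗ g []       q = ≈-refl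
  sumP-map-⊗ g (x ∷ xs) q =
    ≈-trans (⊗-distribʳ q (g x) (sumP (map g xs))) (⊕-cong (≈-refl {g x ⊗ q}) (sumP-map-⊗ g xs q))

  sumP-range-∷ʳ : ∀ (g : ℕ → Poly) a b → a ≤ suc b →
                  sumP (map g (range a (suc b))) ≈ sumP (map g (range a b)) ⊕ g (suc b)
  sumP-range-∷ʳ g a b a≤1+b = begin
    sumP (map g (range a (suc b)))               ≡⟨ cong (λ l → sumP (map g l)) (range-∷ʳ a b a≤1+b) ⟩
    sumP (map g (range a b ++ [ suc b ]))        ≡⟨ cong sumP (List.map-++ g (range a b) [ suc b ]) ⟩
    sumP (map g (range a b) ++ [ g (suc b) ])    ≈⟨ sumP-++ (map g (range a b)) [ g (suc b) ] ⟩
    sumP (map g (range a b)) ⊕ (g (suc b) ⊕ [])  ≈⟨ ⊕-cong (≈-refl {sumP (map g (range a b))})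
                                                             (⊕-identityʳ (g (suc b))) ⟩
    sumP (map g (range a b)) ⊕ g (suc b)         ∎

  factors-∷ʳ : ∀ a b → a ≤ suc b → factors a (suc b) ≈ factors a b ⊗ factor (suc b)
  factors-∷ʳ a b a≤1+b = begin
    factors a (suc b)                                   ≡⟨ cong (λ l → prodP (map factor l)) (range-∷ʳ a b a≤1+b) ⟩
    prodP (map factor (range a b ++ [ suc b ]))         ≡⟨ cong prodP (List.map-++ factor (range a b) [ suc b ]) ⟩
    prodP (map factor (range a b) ++ [ factor (suc b) ]) ≈⟨ prodP-++ (map factor (range a b)) [ factor (suc b) ] ⟩
    factors a b ⊗ (factor (suc b) ⊗ constP (+ 1))       ≈⟨ ⊗-cong (≈-refl {factors a b})
                                                                    (⊗-identityʳ (factor (suc b))) ⟩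
    factors a b ⊗ factor (suc b)                        ∎

  factors-empty : ∀ a → factors (suc a) a ≡ constP (+ 1)
  factors-empty a = cong (λ l → prodP (map factor l)) (range-empty (suc a) a (ℕ.n<1+n a))

  scale≈constP-⊗-constP : ∀ a b p → scale (a ℤ.* b) p ≈ constP a ⊗ (constP b ⊗ p)
  scale≈constP-⊗-constP a b p = ≈-trans (scale≈constP-⊗ (a ℤ.* b) p)
    (≈-trans (⊗-cong (constP-* a b) (≈-refl {p})) (⊗-assoc (constP a) (constP b) p))

  β-diag : ∀ j → β j j ≡ constP (+ 1)
  β-diag j with j ℕ.≟ j
  ... | yes _   = refl
  ... | no j≢j = ⊥-elim (j≢j refl)

  βfactor : ℕ → Poly
  βfactor s = scale (+ s) X ⊕ constP (- + 1)

  β-≢ : ∀ i j → ¬ i ≡ j → β i j ≡ scale (+ j) X ⊗ prodP (map βfactor (range (suc i) (j ∸ 1)))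
  β-≢ i j i≢j with i ℕ.≟ j
  ... | yes i≡j = ⊥-elim (i≢j i≡j)
  ... | no _    = refl

  βfactor≈-factor : ∀ s → βfactor s ≈ negP (factor s)
  βfactor≈-factor s = ≈-trans (⊕-cong (scale≈constP-⊗ (+ s) X) (≈-refl {constP (- + 1)}))
    (solve 2 (λ c x → c :* x :+ con (- + 1) := :- (con (+ 1) :- c :* x)) ≈-refl (constP (+ s)) X)

  prodP-βfactor : ∀ xs → prodP (map βfactor xs) ≈ scale (sgn (length xs)) (prodP (map factor xs))
  prodP-βfactor []       = ≈-sym (≈-trans (scale≈constP-⊗ (+ 1) (constP (+ 1))) (⊗-identityˡ (constP (+ 1))))
  prodP-βfactor (s ∷ xs) = begin
    βfactor s ⊗ prodP (map βfactor xs)           ≈⟨ ⊗-cong (βfactor≈-factor s)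
                                                             (≈-trans (prodP-βfactor xs) (scale≈constP-⊗ S P)) ⟩
    negP (factor s) ⊗ (constP S ⊗ P)             ≈⟨ solve 3 (λ l c p → :- l :* (c :* p) := con (- + 1) :* (c :* (l :* p)))
                                                      ≈-refl (factor s) (constP S) P ⟩
    constP (- + 1) ⊗ (constP S ⊗ (factor s ⊗ P)) ≈⟨ scale≈constP-⊗-constP (- + 1) S (factor s ⊗ P) ⟨
    scale (sgn (suc (length xs))) (prodP (map factor (s ∷ xs))) ∎
    where
    S = sgn (length xs)
    P = prodP (map factor xs)

  -- The t factors s x − 1 = −(1 − s x) contribute (−1)ᵗ, and (−1)^(i+j) (−1)ᵗ = −1 as j = i + t + 1.
  signed-β : ∀ i t → scale (sgn (i ℕ.+ suc (i ℕ.+ t))) (β i (suc (i ℕ.+ t)))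
                   ≈ negP (constP (+ suc (i ℕ.+ t)) ⊗ X ⊗ factors (suc i) (i ℕ.+ t))
  signed-β i t = begin
    scale a (β i j)
      ≡⟨ cong (scale a) (β-≢ i j (ℕ.m≢1+m+n i)) ⟩
    scale a (scale (+ j) X ⊗ prodP (map βfactor L))
      ≈⟨ scale-cong a (⊗-cong (scale≈constP-⊗ (+ j) X) (≈-trans (prodP-βfactor L) (scale≈constP-⊗ b F))) ⟩
    scale a (constP (+ j) ⊗ X ⊗ (constP b ⊗ F))
      ≈⟨ scale≈constP-⊗ a _ ⟩
    constP a ⊗ (constP (+ j) ⊗ X ⊗ (constP b ⊗ F))
      ≈⟨ solve 5 (λ a j x b f → a :* (j :* x :* (b :* f)) := (a :* b) :* (j :* x :* f)) ≈-refl
           (constP a) (constP (+ j)) X (constP b) F ⟩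
    (constP a ⊗ constP b) ⊗ (constP (+ j) ⊗ X ⊗ F)
      ≈⟨ ⊗-cong (constP-* a b) (≈-refl {constP (+ j) ⊗ X ⊗ F}) ⟨
    constP (a ℤ.* b) ⊗ (constP (+ j) ⊗ X ⊗ F)
      ≡⟨ cong (λ s → constP s ⊗ (constP (+ j) ⊗ X ⊗ F)) a*b≡-1 ⟩
    constP (- + 1) ⊗ (constP (+ j) ⊗ X ⊗ F)
      ≈⟨ solve 1 (λ y → con (- + 1) :* y := :- y) ≈-refl (constP (+ j) ⊗ X ⊗ F) ⟩
    negP (constP (+ j) ⊗ X ⊗ F) ∎
    where
    j = suc (i ℕ.+ t)
    a = sgn (i ℕ.+ j)
    L = range (suc i) (i ℕ.+ t)
    b = sgn (length L)
    F = factors (suc i) (i ℕ.+ t)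
    a*b≡-1 : a ℤ.* b ≡ - + 1
    a*b≡-1 = ≡.trans (cong (λ n → a ℤ.* sgn n) (≡.trans (length-range (suc i) (i ℕ.+ t)) (ℕ.m+n∸m≡n i t)))
                      (sgn-i+1+i+t i t)

  denTerm : ℕ → ℕ → Poly
  denTerm j i = scale (sgn (i ℕ.+ j) ℤ.* + i) (β i j)

  numTerm : ℕ → ℕ → Poly
  numTerm j i = scale (sgn (i ℕ.+ j)) (X^ i ⊗ β i j)

  -- Adding the term i = a, which is −a j x ∏_{s=a+1}^{j−1} (1 − s x), turns j ∏_{s=a+1}^{j−1} (1 − s x)
  -- into j ∏_{s=a}^{j−1} (1 − s x).
  Sden-from : ∀ j t a → j ≡ a ℕ.+ t → 1 ≤ a →
              sumP (map (denTerm j) (range a j)) ≈ constP (+ j) ⊗ factors a (j ∸ 1)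
  Sden-from j zero a j≡a+0 1≤a with ≡.trans j≡a+0 (ℕ.+-identityʳ a)
  Sden-from j zero (suc a′) _ _ | refl = begin
    sumP (map (denTerm a) (range a a))             ≡⟨ cong (λ l → sumP (map (denTerm a) l)) (range-singleton a) ⟩
    denTerm a a ⊕ []                               ≈⟨ ⊕-identityʳ (denTerm a a) ⟩
    scale (sgn (a ℕ.+ a) ℤ.* + a) (β a a)          ≡⟨ cong₂ (λ s b → scale (s ℤ.* + a) b) (sgn-n+n a) (β-diag a) ⟩
    scale (+ 1 ℤ.* + a) (constP (+ 1))             ≡⟨ cong (λ z → scale z (constP (+ 1))) (ℤ.*-identityˡ (+ a)) ⟩
    scale (+ a) (constP (+ 1))                     ≈⟨ scale≈constP-⊗ (+ a) (constP (+ 1)) ⟩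
    constP (+ a) ⊗ constP (+ 1)                    ≡⟨ cong (constP (+ a) ⊗_) (factors-empty a′) ⟨
    constP (+ a) ⊗ factors a a′                    ∎
    where a = suc a′
  Sden-from j (suc t) a j≡a+1+t 1≤a with ≡.trans j≡a+1+t (ℕ.+-suc a t)
  ... | refl = begin
    sumP (map (denTerm j) (range a j))
      ≡⟨ cong (λ l → sumP (map (denTerm j) l)) (range-∷ a j (ℕ.m≤n⇒m≤1+n (ℕ.m≤m+n a t))) ⟩
    denTerm j a ⊕ sumP (map (denTerm j) (range (suc a) j))
      ≈⟨ ⊕-cong (scale≈constP-⊗-constP s (+ a) (β a j)) (Sden-from j t (suc a) refl (ℕ.m≤n⇒m≤1+n 1≤a)) ⟩
    constP s ⊗ (constP (+ a) ⊗ β a j) ⊕ J ⊗ F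
      ≈⟨ ⊕-cong (solve 3 (λ s a b → s :* (a :* b) := a :* (s :* b)) ≈-refl (constP s) (constP (+ a)) (β a j))
                (≈-refl {J ⊗ F}) ⟩
    constP (+ a) ⊗ (constP s ⊗ β a j) ⊕ J ⊗ F
      ≈⟨ ⊕-cong (⊗-cong (≈-refl {constP (+ a)}) (≈-trans (≈-sym (scale≈constP-⊗ s (β a j))) (signed-β a t)))
                (≈-refl {J ⊗ F}) ⟩
    constP (+ a) ⊗ negP (J ⊗ X ⊗ F) ⊕ J ⊗ F
      ≈⟨ solve 4 (λ a j x f → a :* :- (j :* x :* f) :+ j :* f := j :* ((con (+ 1) :- a :* x) :* f)) ≈-refl
           (constP (+ a)) J X F ⟩
    J ⊗ (factor a ⊗ F)
      ≡⟨ cong (λ l → J ⊗ prodP (map factor l)) (range-∷ a (a ℕ.+ t) (ℕ.m≤m+n a t)) ⟨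
    J ⊗ factors a (j ∸ 1) ∎
    where
    s = sgn (a ℕ.+ j)
    J = constP (+ j)
    F = factors (suc a) (a ℕ.+ t)

  Sden-closed : ∀ j → Sden (suc j) ≈ constP (+ suc j) ⊗ factors 1 j
  Sden-closed j = begin
    Sden (suc j)
      ≡⟨ cong (λ l → sumP (map (denTerm (suc j)) l)) (range-∷ 0 (suc j) z≤n) ⟩
    denTerm (suc j) 0 ⊕ sumP (map (denTerm (suc j)) (range 1 (suc j)))
      ≈⟨ ⊕-cong (≡⇒≈ (cong (λ z → scale z (β 0 (suc j))) (ℤ.*-zeroʳ (sgn (suc j)))))
                (Sden-from (suc j) j 1 refl (s≤s z≤n)) ⟩
    scale (+ 0) (β 0 (suc j)) ⊕ constP (+ suc j) ⊗ factors 1 j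
      ≈⟨ ⊕-cong (≈-trans (scale≈constP-⊗ (+ 0) (β 0 (suc j))) (⊗-cong constP-0 (≈-refl {β 0 (suc j)})))
                (≈-refl {constP (+ suc j) ⊗ factors 1 j}) ⟩
    constP (+ suc j) ⊗ factors 1 j ∎

  Snum-from : ∀ j t a → j ≡ a ℕ.+ t → 1 ≤ j →
              sumP (map (numTerm j) (range a j)) ≈ X^ j ⊕ negP (constP (+ j) ⊗ X ⊗ tailSum a (j ∸ 1))
  Snum-from j zero a j≡a+0 1≤j with ≡.trans j≡a+0 (ℕ.+-identityʳ a)
  Snum-from j zero (suc a′) _ _ | refl = begin
    sumP (map (numTerm a) (range a a))
      ≡⟨ cong (λ l → sumP (map (numTerm a) l)) (range-singleton a) ⟩
    numTerm a a ⊕ []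
      ≈⟨ ⊕-identityʳ (numTerm a a) ⟩
    scale (sgn (a ℕ.+ a)) (X^ a ⊗ β a a)
      ≡⟨ cong₂ (λ s b → scale s (X^ a ⊗ b)) (sgn-n+n a) (β-diag a) ⟩
    scale (+ 1) (X^ a ⊗ constP (+ 1))
      ≈⟨ scale≈constP-⊗ (+ 1) (X^ a ⊗ constP (+ 1)) ⟩
    constP (+ 1) ⊗ (X^ a ⊗ constP (+ 1))
      ≈⟨ solve 3 (λ y j x → con (+ 1) :* (y :* con (+ 1)) := y :+ :- (j :* x :* con (+ 0))) ≈-refl
           (X^ a) (constP (+ a)) X ⟩
    X^ a ⊕ negP (constP (+ a) ⊗ X ⊗ constP (+ 0))
      ≈⟨ ⊕-cong (≈-refl {X^ a}) (negP-cong (⊗-cong (≈-refl {constP (+ a) ⊗ X}) constP-0)) ⟩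
    X^ a ⊕ negP (constP (+ a) ⊗ X ⊗ [])
      ≡⟨ cong (λ l → X^ a ⊕ negP (constP (+ a) ⊗ X ⊗ sumP (map (λ d → X^ d ⊗ factors (suc d) a′) l)))
              (range-empty a a′ (ℕ.n<1+n a′)) ⟨
    X^ a ⊕ negP (constP (+ a) ⊗ X ⊗ tailSum a a′) ∎
    where a = suc a′
  Snum-from j (suc t) a j≡a+1+t 1≤j with ≡.trans j≡a+1+t (ℕ.+-suc a t)
  ... | refl = begin
    sumP (map (numTerm j) (range a j))
      ≡⟨ cong (λ l → sumP (map (numTerm j) l)) (range-∷ a j (ℕ.m≤n⇒m≤1+n (ℕ.m≤m+n a t))) ⟩
    numTerm j a ⊕ sumP (map (numTerm j) (range (suc a) j))
      ≈⟨ ⊕-cong (scale≈constP-⊗ s (X^ a ⊗ β a j)) (Snum-from j t (suc a) refl 1≤j) ⟩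
    constP s ⊗ (X^ a ⊗ β a j) ⊕ (X^ j ⊕ negP (J ⊗ X ⊗ R))
      ≈⟨ ⊕-cong (solve 3 (λ s y b → s :* (y :* b) := y :* (s :* b)) ≈-refl (constP s) (X^ a) (β a j))
                (≈-refl {X^ j ⊕ negP (J ⊗ X ⊗ R)}) ⟩
    X^ a ⊗ (constP s ⊗ β a j) ⊕ (X^ j ⊕ negP (J ⊗ X ⊗ R))
      ≈⟨ ⊕-cong (⊗-cong (≈-refl {X^ a}) (≈-trans (≈-sym (scale≈constP-⊗ s (β a j))) (signed-β a t)))
                (≈-refl {X^ j ⊕ negP (J ⊗ X ⊗ R)}) ⟩
    X^ a ⊗ negP (J ⊗ X ⊗ F) ⊕ (X^ j ⊕ negP (J ⊗ X ⊗ R))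
      ≈⟨ solve 6 (λ y j x f z r → y :* :- (j :* x :* f) :+ (z :+ :- (j :* x :* r))
                                := z :+ :- (j :* x :* (y :* f :+ r)))
           ≈-refl (X^ a) J X F (X^ j) R ⟩
    X^ j ⊕ negP (J ⊗ X ⊗ (X^ a ⊗ F ⊕ R))
      ≡⟨ cong (λ l → X^ j ⊕ negP (J ⊗ X ⊗ sumP (map (λ d → X^ d ⊗ factors (suc d) (a ℕ.+ t)) l)))
              (range-∷ a (a ℕ.+ t) (ℕ.m≤m+n a t)) ⟨
    X^ j ⊕ negP (J ⊗ X ⊗ tailSum a (j ∸ 1)) ∎
    where
    s = sgn (a ℕ.+ j)
    J = constP (+ j)
    F = factors (suc a) (a ℕ.+ t)
    R = tailSum (suc a) (a ℕ.+ t)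

  Snum-closed : ∀ j → Snum (suc j) ≈ X^ (suc j) ⊕ negP (constP (+ suc j) ⊗ X ⊗ tailSum 0 j)
  Snum-closed j = Snum-from (suc j) (suc j) 0 refl (s≤s z≤n)

  tailSum-∷ʳ : ∀ J → tailSum 0 (suc J) ≈ tailSum 0 J ⊗ factor (suc J) ⊕ X^ (suc J)
  tailSum-∷ʳ J = begin
    tailSum 0 (suc J)                                ≈⟨ sumP-range-∷ʳ g 0 J z≤n ⟩
    sumP (map g (range 0 J)) ⊕ g (suc J)             ≈⟨ ⊕-cong (sumP-map-cong (All.tabulate split)) (≈-refl {g (suc J)}) ⟩
    sumP (map (λ d → h d ⊗ factor (suc J)) (range 0 J)) ⊕ g (suc J)
                                                     ≈⟨ ⊕-cong (sumP-map-⊗ h (range 0 J) (factor (suc J))) (≈-refl {g (suc J)}) ⟨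
    tailSum 0 J ⊗ factor (suc J) ⊕ g (suc J)         ≡⟨ cong (λ p → tailSum 0 J ⊗ factor (suc J) ⊕ X^ (suc J) ⊗ p)
                                                             (factors-empty (suc J)) ⟩
    tailSum 0 J ⊗ factor (suc J) ⊕ X^ (suc J) ⊗ constP (+ 1)
                                                     ≈⟨ ⊕-cong (≈-refl {tailSum 0 J ⊗ factor (suc J)}) (⊗-identityʳ (X^ (suc J))) ⟩
    tailSum 0 J ⊗ factor (suc J) ⊕ X^ (suc J)        ∎
    where
    g = λ d → X^ d ⊗ factors (suc d) (suc J)
    h = λ d → X^ d ⊗ factors (suc d) J
    split : ∀ {d} → d ∈ range 0 J → g d ≈ h d ⊗ factor (suc J)
    split {d} d∈ = ≈-trans (⊗-cong (≈-refl {X^ d}) (factors-∷ʳ (suc d) J (s≤s (proj₂ (∈-range⁻ {0} {J} d∈)))))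
                           (≈-sym (⊗-assoc (X^ d) (factors (suc d) J) (factor (suc J))))

  Den-sum-closed : ∀ J → constP (+ 1) ⊕ negP (X ⊗ sumP (map Sden (range 1 J))) ≈ factors 1 J
  Den-sum-closed zero    = ⊕-cong (≈-refl {constP (+ 1)}) (negP-cong (⊗-zeroʳ X))
  Den-sum-closed (suc J) = begin
    constP (+ 1) ⊕ negP (X ⊗ sumP (map Sden (range 1 (suc J))))
      ≈⟨ ⊕-cong (≈-refl {constP (+ 1)}) (negP-cong (⊗-cong (≈-refl {X})
           (≈-trans (sumP-range-∷ʳ Sden 1 J (s≤s z≤n)) (⊕-cong (≈-refl {S}) (Sden-closed J))))) ⟩
    constP (+ 1) ⊕ negP (X ⊗ (S ⊕ C ⊗ factors 1 J))
      ≈⟨ solve 4 (λ x s c p → con (+ 1) :+ :- (x :* (s :+ c :* p))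
                            := (con (+ 1) :+ :- (x :* s)) :+ :- (x :* (c :* p)))
           ≈-refl X S C (factors 1 J) ⟩
    (constP (+ 1) ⊕ negP (X ⊗ S)) ⊕ negP (X ⊗ (C ⊗ factors 1 J))
      ≈⟨ ⊕-cong (Den-sum-closed J) (≈-refl {negP (X ⊗ (C ⊗ factors 1 J))}) ⟩
    factors 1 J ⊕ negP (X ⊗ (C ⊗ factors 1 J))
      ≈⟨ solve 3 (λ x c p → p :+ :- (x :* (c :* p)) := p :* (con (+ 1) :+ :- (c :* x))) ≈-refl X C (factors 1 J) ⟩
    factors 1 J ⊗ factor (suc J)
      ≈⟨ factors-∷ʳ 1 J (s≤s z≤n) ⟨
    factors 1 (suc J) ∎
    where
    S = sumP (map Sden (range 1 J))
    C = constP (+ suc J)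

  Num-sum-closed : ∀ J → constP (+ 1) ⊕ sumP (map Snum (range 1 J)) ≈ tailSum 0 J
  Num-sum-closed zero    =
    ≈-sym (≈-trans (⊕-identityʳ (constP (+ 1) ⊗ constP (+ 1))) (⊗-identityˡ (constP (+ 1))))
  Num-sum-closed (suc J) = begin
    constP (+ 1) ⊕ sumP (map Snum (range 1 (suc J)))
      ≈⟨ ⊕-cong (≈-refl {constP (+ 1)})
                (≈-trans (sumP-range-∷ʳ Snum 1 J (s≤s z≤n)) (⊕-cong (≈-refl {S}) (Snum-closed J))) ⟩
    constP (+ 1) ⊕ (S ⊕ (X^ (suc J) ⊕ negP (C ⊗ X ⊗ R)))
      ≈⟨ ⊕-assoc (constP (+ 1)) S _ ⟨
    (constP (+ 1) ⊕ S) ⊕ (X^ (suc J) ⊕ negP (C ⊗ X ⊗ R))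
      ≈⟨ ⊕-cong (Num-sum-closed J) (≈-refl {X^ (suc J) ⊕ negP (C ⊗ X ⊗ R)}) ⟩
    R ⊕ (X^ (suc J) ⊕ negP (C ⊗ X ⊗ R))
      ≈⟨ solve 4 (λ r y c x → r :+ (y :+ :- (c :* x :* r)) := r :* (con (+ 1) :+ :- (c :* x)) :+ y) ≈-refl
           R (X^ (suc J)) C X ⟩
    R ⊗ factor (suc J) ⊕ X^ (suc J)
      ≈⟨ tailSum-∷ʳ J ⟨
    tailSum 0 (suc J) ∎
    where
    S = sumP (map Snum (range 1 J))
    C = constP (+ suc J)
    R = tailSum 0 J

  Den-closed : ∀ k′ → Den (suc (suc k′)) ≈ factors 1 k′ ⊗ factor (suc (suc k′))
  Den-closed k′ = begin
    Den (suc (suc k′))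
      ≈⟨ solve 3 (λ x s d → (con (+ 1) :- x) :+ :- (x :* (con (+ 1) :- x) :* s) :+ :- (x :* d)
                          := (con (+ 1) :- x) :* (con (+ 1) :+ :- (x :* s)) :+ :- (x :* d))
           ≈-refl X S (Sden (suc k′)) ⟩
    oneMinusX ⊗ (constP (+ 1) ⊕ negP (X ⊗ S)) ⊕ negP (X ⊗ Sden (suc k′))
      ≈⟨ ⊕-cong (⊗-cong (≈-refl {oneMinusX}) (Den-sum-closed k′))
                (negP-cong (⊗-cong (≈-refl {X}) (Sden-closed k′))) ⟩
    oneMinusX ⊗ P ⊕ negP (X ⊗ (constP (+ suc k′) ⊗ P))
      ≈⟨ solve 3 (λ x c p → (con (+ 1) :- x) :* p :+ :- (x :* (c :* p))
                          := p :* (con (+ 1) :+ :- ((con (+ 1) :+ c) :* x)))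
           ≈-refl X (constP (+ suc k′)) P ⟩
    P ⊗ factor (suc (suc k′)) ∎
    where
    S = sumP (map Sden (range 1 k′))
    P = factors 1 k′

  Num-closed : ∀ k′ → Num (suc (suc k′)) ≈ tailSum 0 k′ ⊗ factor (suc (suc k′)) ⊕ X^ (suc k′)
  Num-closed k′ = begin
    Num (suc (suc k′))
      ≈⟨ solve 3 (λ x s d → (con (+ 1) :- x) :+ (con (+ 1) :- x) :* s :+ d
                          := (con (+ 1) :- x) :* (con (+ 1) :+ s) :+ d)
           ≈-refl X S (Snum (suc k′)) ⟩
    oneMinusX ⊗ (constP (+ 1) ⊕ S) ⊕ Snum (suc k′)
      ≈⟨ ⊕-cong (⊗-cong (≈-refl {oneMinusX}) (Num-sum-closed k′)) (Snum-closed k′) ⟩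
    oneMinusX ⊗ R ⊕ (X^ (suc k′) ⊕ negP (constP (+ suc k′) ⊗ X ⊗ R))
      ≈⟨ solve 4 (λ x c r y → (con (+ 1) :- x) :* r :+ (y :+ :- (c :* x :* r))
                          := r :* (con (+ 1) :+ :- ((con (+ 1) :+ c) :* x)) :+ y)
           ≈-refl X (constP (+ suc k′)) R (X^ (suc k′)) ⟩
    R ⊗ factor (suc (suc k′)) ⊕ X^ (suc k′) ∎
    where
    S = sumP (map Snum (range 1 k′))
    R = tailSum 0 k′

module GeneratingFunction where

  open PowerSeries
  open PolynomialRing
  open ClosedForms
  open import Data.Nat as ℕ using (ℕ; zero; suc; _≤_; z≤n; s≤s)
  import Data.Nat.Properties as ℕ
  open import Data.Integer as ℤ using (+_; _+_; _*_; _-_)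
  import Data.Integer.Properties as ℤ
  open import Data.Integer.Solver using (module +-*-Solver)
  open import Data.List using (_∷_; [])
  open import Relation.Binary.PropositionalEquality
  open +-*-Solver using (solve; _:+_; _:*_; _:-_; _:=_; con)

  shiftⁿ : ℕ → Series → Series
  shiftⁿ zero    f = f
  shiftⁿ (suc j) f = shift (shiftⁿ j f)

  coeff-⊛ : ∀ p q → coeff p ⊛ q ≗ coeff (p ⊗ q)
  coeff-⊛ p q n = begin
    (coeff p ⊛ q) n        ≡⟨ ⊛-congˡ q (λ m → sym (δ₀-⊛ p m)) n ⟩
    ((δ₀ ⊛ p) ⊛ q) n       ≡⟨ ⊛-⊗ δ₀ p q n ⟨
    (δ₀ ⊛ (p ⊗ q)) n       ≡⟨ δ₀-⊛ (p ⊗ q) n ⟩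
    coeff (p ⊗ q) n        ∎
    where open ≡-Reasoning

  coeff-X⊗ : ∀ p → coeff (X ⊗ p) ≗ shift (coeff p)
  coeff-X⊗ p n = begin
    coeff (X ⊗ p) n          ≡⟨ coeff-⊛ X p n ⟨
    (coeff X ⊛ p) n          ≡⟨ ⊛-congˡ p coeff-X n ⟩
    (shift δ₀ ⊛ p) n         ≡⟨ shift-⊛ δ₀ p n ⟩
    shift (δ₀ ⊛ p) n         ≡⟨ shift-cong (δ₀-⊛ p) n ⟩
    shift (coeff p) n        ∎
    where
    open ≡-Reasoning
    coeff-X : coeff X ≗ shift δ₀
    coeff-X zero          = refl
    coeff-X (suc zero)    = refl
    coeff-X (suc (suc m)) = refl

  ⊛-X : ∀ f → f ⊛ X ≗ shift f
  ⊛-X f n = begin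
    (f ⊛ X) n                              ≡⟨ ⊛-∷ f (+ 0) (+ 1 ∷ []) n ⟩
    + 0 + shift (f ⊛ constP (+ 1)) n       ≡⟨ ℤ.+-identityˡ _ ⟩
    shift (f ⊛ constP (+ 1)) n             ≡⟨ shift-cong (λ m → trans (⊛-constP f (+ 1) m) (ℤ.*-identityˡ (f m))) n ⟩
    shift f n                              ∎
    where open ≡-Reasoning

  ⊛-factor : ∀ f c → f ⊛ factor c ≗ λ n → f n - + c * shift f n
  ⊛-factor f c n = begin
    (f ⊛ factor c) n                             ≡⟨ ⊛-⊕ f (constP (+ 1)) (negP cX) n ⟩
    (f ⊛ constP (+ 1)) n + (f ⊛ negP cX) n       ≡⟨ cong₂ _+_ (⊛-constP f (+ 1) n) (⊛-negP f cX n) ⟩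
    + 1 * f n - (f ⊛ cX) n                       ≡⟨ cong₂ _-_ (ℤ.*-identityˡ (f n)) (⊛-⊗ f (constP (+ c)) X n) ⟩
    f n - ((f ⊛ constP (+ c)) ⊛ X) n             ≡⟨ cong (f n -_) (⊛-X (f ⊛ constP (+ c)) n) ⟩
    f n - shift (f ⊛ constP (+ c)) n             ≡⟨ cong (f n -_) (shift-cong (⊛-constP f (+ c)) n) ⟩
    f n - shift (λ m → + c * f m) n              ≡⟨ cong (f n -_) (shift-* n) ⟩
    f n - + c * shift f n                        ∎
    where
    open ≡-Reasoning
    cX = constP (+ c) ⊗ X
    shift-* : ∀ m → shift (λ m → + c * f m) m ≡ + c * shift f m
    shift-* zero    = sym (ℤ.*-zeroʳ (+ c))
    shift-* (suc m) = refl

  shiftⁿ-⊛-factor : ∀ c F F′ → F 0 ≡ + 1 → (∀ n → F (suc n) ≡ + c * F n + F′ n) →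
                    ∀ j → shiftⁿ j F ⊛ factor c ≗ λ n → coeff (X^ j) n + shiftⁿ (suc j) F′ n
  shiftⁿ-⊛-factor c F F′ F0 F-suc j n = trans (⊛-factor (shiftⁿ j F) c n) (go j n)
    where
    go : ∀ j n → shiftⁿ j F n - + c * shift (shiftⁿ j F) n ≡ coeff (X^ j) n + shiftⁿ (suc j) F′ n
    go zero    zero    rewrite F0 | ℤ.*-zeroʳ (+ c) = refl
    go zero    (suc n) rewrite F-suc n = trans
      (solve 3 (λ c a b → c :* a :+ b :- c :* a := b) refl (+ c) (F n) (F′ n)) (sym (ℤ.+-identityˡ (F′ n)))
    go (suc j) zero    rewrite ℤ.*-zeroʳ (+ c) | coeff-X⊗ (X^ j) 0 = refl
    go (suc j) (suc n) rewrite coeff-X⊗ (X^ j) (suc n) = go j n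

  shiftⁿ-zero : ∀ j n → shiftⁿ j (λ _ → + 0) n ≡ + 0
  shiftⁿ-zero zero    n       = refl
  shiftⁿ-zero (suc j) zero    = refl
  shiftⁿ-zero (suc j) (suc n) = shiftⁿ-zero j n

  ⊛-⊗-factor : ∀ h P R j c F F′ → F 0 ≡ + 1 → (∀ n → F (suc n) ≡ + c * F n + F′ n) →
               h ⊛ P ≗ (λ n → coeff R n + shiftⁿ j F n) →
               h ⊛ (P ⊗ factor c) ≗ λ n → coeff (R ⊗ factor c ⊕ X^ j) n + shiftⁿ (suc j) F′ n
  ⊛-⊗-factor h P R j c F F′ F0 F-suc hP≗ n = begin
    (h ⊛ (P ⊗ factor c)) n                                ≡⟨ ⊛-⊗ h P (factor c) n ⟩
    ((h ⊛ P) ⊛ factor c) n                                ≡⟨ ⊛-congˡ (factor c) hP≗ n ⟩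
    ((λ m → coeff R m + shiftⁿ j F m) ⊛ factor c) n       ≡⟨ +-⊛ (coeff R) (shiftⁿ j F) (factor c) n ⟩
    (coeff R ⊛ factor c) n + (shiftⁿ j F ⊛ factor c) n    ≡⟨ cong₂ _+_ (coeff-⊛ R (factor c) n)
                                                                       (shiftⁿ-⊛-factor c F F′ F0 F-suc j n) ⟩
    coeff (R ⊗ factor c) n + (coeff (X^ j) n + G′ n)      ≡⟨ ℤ.+-assoc (coeff (R ⊗ factor c) n) _ _ ⟨
    coeff (R ⊗ factor c) n + coeff (X^ j) n + G′ n        ≡⟨ cong (_+ G′ n) (coeff-⊕ (R ⊗ factor c) (X^ j) n) ⟨
    coeff (R ⊗ factor c ⊕ X^ j) n + G′ n                  ∎
    where
    open ≡-Reasoning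
    G′ = shiftⁿ (suc j) F′

  module _ (k′ : ℕ) (G : ℕ → Series)
           (G-zero : ∀ m → G m 0 ≡ + 1)
           (G-suc : ∀ m n → m ≤ suc k′ → G m (suc n) ≡ + m * G m n + G (suc m) n)
           (G-top : G (suc (suc k′)) ≗ G (suc k′)) where

    G₀-⊛-factors : ∀ J → J ≤ k′ →
                   G 0 ⊛ factors 1 J ≗ λ n → coeff (tailSum 0 J) n + shiftⁿ (suc J) (G (suc J)) n
    G₀-⊛-factors zero    _       n = trans (⊛-constP (G 0) (+ 1) n) (trans (ℤ.*-identityˡ (G 0 n)) (G₀≗ n))
      where
      G₀≗ : ∀ n → G 0 n ≡ coeff (tailSum 0 0) n + shift (G 1) n
      G₀≗ zero    = G-zero 0
      G₀≗ (suc n) = G-suc 0 n z≤n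
    G₀-⊛-factors (suc J) 1+J≤k′ n = begin
      (G 0 ⊛ factors 1 (suc J)) n
        ≡⟨ ⊛-≗ (factors-∷ʳ 1 J (s≤s z≤n)) (G 0) n ⟩
      (G 0 ⊛ (factors 1 J ⊗ factor (suc J))) n
        ≡⟨ ⊛-⊗-factor (G 0) (factors 1 J) (tailSum 0 J) (suc J) (suc J) (G (suc J)) (G (suc (suc J)))
             (G-zero (suc J)) (λ m → G-suc (suc J) m (s≤s (ℕ.<⇒≤ 1+J≤k′)))
             (G₀-⊛-factors J (ℕ.<⇒≤ 1+J≤k′)) n ⟩
      coeff (tailSum 0 J ⊗ factor (suc J) ⊕ X^ (suc J)) n + shiftⁿ (suc (suc J)) (G (suc (suc J))) n
        ≡⟨ cong (_+ shiftⁿ (suc (suc J)) (G (suc (suc J))) n) (coeff-cong (tailSum-∷ʳ J) n) ⟨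
      coeff (tailSum 0 (suc J)) n + shiftⁿ (suc (suc J)) (G (suc (suc J))) n ∎
      where open ≡-Reasoning

    G₀-⊛-Den : G 0 ⊛ Den (suc (suc k′)) ≗ coeff (Num (suc (suc k′)))
    G₀-⊛-Den n = begin
      (G 0 ⊛ Den k) n
        ≡⟨ ⊛-≗ (Den-closed k′) (G 0) n ⟩
      (G 0 ⊛ (factors 1 k′ ⊗ factor k)) n
        ≡⟨ ⊛-⊗-factor (G 0) (factors 1 k′) (tailSum 0 k′) (suc k′) k (G (suc k′)) (λ _ → + 0)
             (G-zero (suc k′)) G-last (G₀-⊛-factors k′ ℕ.≤-refl) n ⟩
      coeff (tailSum 0 k′ ⊗ factor k ⊕ X^ (suc k′)) n + shiftⁿ k (λ _ → + 0) n
        ≡⟨ trans (cong (λ z → coeff (tailSum 0 k′ ⊗ factor k ⊕ X^ (suc k′)) n + z) (shiftⁿ-zero k n))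
                 (ℤ.+-identityʳ _) ⟩
      coeff (tailSum 0 k′ ⊗ factor k ⊕ X^ (suc k′)) n
        ≡⟨ coeff-cong (Num-closed k′) n ⟨
      coeff (Num k) n ∎
      where
      open ≡-Reasoning
      k = suc (suc k′)
      G-last : ∀ n → G (suc k′) (suc n) ≡ + k * G (suc k′) n + + 0
      G-last n = begin
        G (suc k′) (suc n)                            ≡⟨ G-suc (suc k′) n ℕ.≤-refl ⟩
        + suc k′ * G (suc k′) n + G k n               ≡⟨ cong (λ z → + suc k′ * G (suc k′) n + z) (G-top n) ⟩
        + suc k′ * G (suc k′) n + G (suc k′) n        ≡⟨ solve 2 (λ c g → c :* g :+ g := (con (+ 1) :+ c) :* g :+ con (+ 0))
                                                               refl (+ suc k′) (G (suc k′) n) ⟩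
        + k * G (suc k′) n + + 0                      ∎

module Enumeration (k′ : ℕ) where

  open Ranges
  open import Data.Nat using (ℕ; zero; suc; _≤_; _∸_; _⊔_; _+_; _*_; z≤n; s≤s)
  import Data.Nat.Properties as ℕ
  open import Data.List using (List; []; _∷_; map; _++_; length; [_])
  import Data.List.Properties as List
  open import Data.List.Membership.Propositional using (_∈_)
  open import Data.List.Membership.Propositional.Properties using (∈-++⁺ˡ; ∈-++⁺ʳ; ∈-++⁻; ∈-map⁺; ∈-map⁻)
  open import Data.List.Relation.Unary.Any using (here; there)
  open import Data.List.Relation.Unary.All as All using (All; []; _∷_)
  open import Data.List.Relation.Unary.Unique.Propositional using (Unique; []; _∷_)
  import Data.List.Relation.Unary.Unique.Propositional.Properties as Unique
  open import Data.Product using (∃₂; _×_; _,_; proj₁; proj₂)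
  open import Data.Sum using (inj₁; inj₂)
  open import Data.Unit using (⊤; tt)
  open import Relation.Binary.PropositionalEquality hiding ([_])
  open import Relation.Nullary using (¬_)

  Admissible : ℕ → List ℕ → Set
  Admissible m []      = ⊤
  Admissible m (a ∷ w) = 1 ≤ a × a ≤ suc m × m ≤ a + k′ × Admissible (m ⊔ a) w

  nextLetters : ℕ → List ℕ
  nextLetters m = range (1 ⊔ (m ∸ k′)) (suc m)

  mutual
    words : ℕ → ℕ → List (List ℕ)
    words m zero    = [ [] ]
    words m (suc n) = wordsStartingIn m (nextLetters m) n

    wordsStartingIn : ℕ → List ℕ → ℕ → List (List ℕ)
    wordsStartingIn m []       n = []
    wordsStartingIn m (a ∷ as) n = map (a ∷_) (words (m ⊔ a) n) ++ wordsStartingIn m as n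

  ∈-wordsStartingIn⁻ : ∀ m as n {w} → w ∈ wordsStartingIn m as n →
                       ∃₂ λ a w′ → a ∈ as × w ≡ a ∷ w′ × w′ ∈ words (m ⊔ a) n
  ∈-wordsStartingIn⁻ m (a ∷ as) n w∈ with ∈-++⁻ (map (a ∷_) (words (m ⊔ a) n)) w∈
  ... | inj₁ w∈₁ with ∈-map⁻ (a ∷_) w∈₁
  ...   | w′ , w′∈ , refl = a , w′ , here refl , refl , w′∈
  ∈-wordsStartingIn⁻ m (a ∷ as) n w∈ | inj₂ w∈₂ with ∈-wordsStartingIn⁻ m as n w∈₂
  ... | b , w′ , b∈ , w≡b∷w′ , w′∈ = b , w′ , there b∈ , w≡b∷w′ , w′∈

  ∈-wordsStartingIn⁺ : ∀ m as n {a w′} → a ∈ as → w′ ∈ words (m ⊔ a) n → a ∷ w′ ∈ wordsStartingIn m as n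
  ∈-wordsStartingIn⁺ m (a ∷ as) n (here refl) w′∈ = ∈-++⁺ˡ (∈-map⁺ (a ∷_) w′∈)
  ∈-wordsStartingIn⁺ m (b ∷ as) n (there a∈) w′∈ =
    ∈-++⁺ʳ (map (b ∷_) (words (m ⊔ b) n)) (∈-wordsStartingIn⁺ m as n a∈ w′∈)

  ∈-nextLetters⁻ : ∀ m {a} → a ∈ nextLetters m → 1 ≤ a × a ≤ suc m × m ≤ a + k′
  ∈-nextLetters⁻ m {a} a∈ with ∈-range⁻ a∈
  ... | lo≤a , a≤1+m = ℕ.≤-trans (ℕ.m≤m⊔n 1 (m ∸ k′)) lo≤a , a≤1+m ,
    ℕ.≤-trans (ℕ.m≤n+m∸n m k′)
      (subst (_≤ a + k′) (ℕ.+-comm (m ∸ k′) k′) (ℕ.+-monoˡ-≤ k′ (ℕ.≤-trans (ℕ.m≤n⊔m 1 (m ∸ k′)) lo≤a)))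

  ∈-nextLetters⁺ : ∀ m {a} → 1 ≤ a → a ≤ suc m → m ≤ a + k′ → a ∈ nextLetters m
  ∈-nextLetters⁺ m {a} 1≤a a≤1+m m≤a+k′ =
    ∈-range⁺ (ℕ.⊔-lub 1≤a (ℕ.m≤n+o⇒m∸n≤o m k′ (subst (m ≤_) (ℕ.+-comm a k′) m≤a+k′))) a≤1+m

  ∈-words⁻ : ∀ m n {w} → w ∈ words m n → length w ≡ n × Admissible m w
  ∈-words⁻ m zero    (here refl) = refl , tt
  ∈-words⁻ m (suc n) w∈ with ∈-wordsStartingIn⁻ m (nextLetters m) n w∈
  ... | a , w′ , a∈ , refl , w′∈ with ∈-nextLetters⁻ m a∈ | ∈-words⁻ (m ⊔ a) n w′∈
  ...   | 1≤a , a≤1+m , m≤a+k′ | |w′|≡n , adm = cong suc |w′|≡n , 1≤a , a≤1+m , m≤a+k′ , adm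

  ∈-words⁺ : ∀ m n w → length w ≡ n → Admissible m w → w ∈ words m n
  ∈-words⁺ m zero    []      refl _ = here refl
  ∈-words⁺ m (suc n) (a ∷ w) |w|≡1+n (1≤a , a≤1+m , m≤a+k′ , adm) =
    ∈-wordsStartingIn⁺ m (nextLetters m) n (∈-nextLetters⁺ m 1≤a a≤1+m m≤a+k′)
      (∈-words⁺ (m ⊔ a) n w (ℕ.suc-injective |w|≡1+n) adm)

  mutual
    words-unique : ∀ m n → Unique (words m n)
    words-unique m zero    = [] ∷ []
    words-unique m (suc n) = wordsStartingIn-unique m (nextLetters m) n (range-unique _ _)

    wordsStartingIn-unique : ∀ m as n → Unique as → Unique (wordsStartingIn m as n)
    wordsStartingIn-unique m []       n _            = []
    wordsStartingIn-unique m (a ∷ as) n (a∉as ∷ as!) =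
      Unique.++⁺ (Unique.map⁺ (λ eq → proj₂ (List.∷-injective eq)) (words-unique (m ⊔ a) n))
                 (wordsStartingIn-unique m as n as!) disjoint
      where
      disjoint : ∀ {v} → ¬ (v ∈ map (a ∷_) (words (m ⊔ a) n) × v ∈ wordsStartingIn m as n)
      disjoint (v∈₁ , v∈₂) with ∈-map⁻ (a ∷_) v∈₁ | ∈-wordsStartingIn⁻ m as n v∈₂
      ... | _ , _ , refl | b , _ , b∈ , eq , _ = All.lookup a∉as b∈ (proj₁ (List.∷-injective eq))

  count : ℕ → ℕ → ℕ
  count m n = length (words m n)

  wordsStartingIn-++ : ∀ m as bs n →
                       wordsStartingIn m (as ++ bs) n ≡ wordsStartingIn m as n ++ wordsStartingIn m bs n
  wordsStartingIn-++ m []       bs n = refl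
  wordsStartingIn-++ m (a ∷ as) bs n rewrite wordsStartingIn-++ m as bs n =
    sym (List.++-assoc (map (a ∷_) (words (m ⊔ a) n)) _ _)

  -- Repeating an old letter does not change the maximum.
  length-wordsStartingIn-old : ∀ m as n → All (_≤ m) as → length (wordsStartingIn m as n) ≡ length as * count m n
  length-wordsStartingIn-old m []       n []          = refl
  length-wordsStartingIn-old m (a ∷ as) n (a≤m ∷ as≤m) =
    trans (List.length-++ (map (a ∷_) (words (m ⊔ a) n)))
      (cong₂ _+_ (trans (List.length-map (a ∷_) (words (m ⊔ a) n)) (cong (λ z → count z n) (ℕ.m≥n⇒m⊔n≡m a≤m)))
                 (length-wordsStartingIn-old m as n as≤m))

  -- the number of old letters that may be repeated after a prefix with maximum m
  choices : ℕ → ℕ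
  choices m = suc m ∸ (1 ⊔ (m ∸ k′))

  count-suc : ∀ m n → count m (suc n) ≡ choices m * count m n + count (suc m) n
  count-suc m n = begin
    length (wordsStartingIn m (nextLetters m) n)
      ≡⟨ cong (λ l → length (wordsStartingIn m l n)) (range-∷ʳ lo m lo≤1+m) ⟩
    length (wordsStartingIn m (range lo m ++ [ suc m ]) n)
      ≡⟨ cong length (wordsStartingIn-++ m (range lo m) [ suc m ] n) ⟩
    length (wordsStartingIn m (range lo m) n ++ wordsStartingIn m [ suc m ] n)
      ≡⟨ List.length-++ (wordsStartingIn m (range lo m) n) ⟩
    length (wordsStartingIn m (range lo m) n) + length (wordsStartingIn m [ suc m ] n)
      ≡⟨ cong₂ _+_ old new ⟩
    choices m * count m n + count (suc m) n ∎
    where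
    open ≡-Reasoning
    lo = 1 ⊔ (m ∸ k′)
    lo≤1+m : lo ≤ suc m
    lo≤1+m = ℕ.⊔-lub (s≤s z≤n) (ℕ.≤-trans (ℕ.m∸n≤m m k′) (ℕ.n≤1+n m))
    old : length (wordsStartingIn m (range lo m) n) ≡ choices m * count m n
    old = trans (length-wordsStartingIn-old m (range lo m) n (All.tabulate (λ a∈ → proj₂ (∈-range⁻ a∈))))
                (cong (_* count m n) (length-range lo m))
    new : length (wordsStartingIn m [ suc m ] n) ≡ count (suc m) n
    new = begin
      length (map (suc m ∷_) (words (m ⊔ suc m) n) ++ [])  ≡⟨ cong length (List.++-identityʳ new-words) ⟩
      length (map (suc m ∷_) (words (m ⊔ suc m) n))       ≡⟨ List.length-map (suc m ∷_) (words (m ⊔ suc m) n) ⟩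
      count (m ⊔ suc m) n                                 ≡⟨ cong (λ z → count z n) (ℕ.m≤n⇒m⊔n≡n (ℕ.n≤1+n m)) ⟩
      count (suc m) n                                     ∎
      where new-words = map (suc m ∷_) (words (m ⊔ suc m) n)

  choices-small : ∀ m → m ≤ suc k′ → choices m ≡ m
  choices-small m m≤1+k′ = cong (suc m ∸_)
    (ℕ.m≥n⇒m⊔n≡m {1} {m ∸ k′} (ℕ.m≤n+o⇒m∸n≤o m k′ (subst (m ≤_) (ℕ.+-comm 1 k′) m≤1+k′)))

  choices-large : ∀ m → suc k′ ≤ m → choices m ≡ suc k′
  choices-large m 1+k′≤m = trans (cong (suc m ∸_) (ℕ.m≤n⇒m⊔n≡n {1} {m ∸ k′} (ℕ.m+n≤o⇒m≤o∸n 1 1+k′≤m)))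
    (ℕ.m∸[m∸n]≡n {suc m} {suc k′} (s≤s (ℕ.≤-trans (ℕ.n≤1+n k′) 1+k′≤m)))

  count-large : ∀ n m m′ → suc k′ ≤ m → suc k′ ≤ m′ → count m n ≡ count m′ n
  count-large zero    m m′ _ _ = refl
  count-large (suc n) m m′ 1+k′≤m 1+k′≤m′ = begin
    count m (suc n)                          ≡⟨ count-suc m n ⟩
    choices m * count m n + count (suc m) n  ≡⟨ cong₂ (λ c r → c * count m n + r) (choices-large m 1+k′≤m)
                                                  (count-large n (suc m) (suc m′) (ℕ.m≤n⇒m≤1+n 1+k′≤m)
                                                                                 (ℕ.m≤n⇒m≤1+n 1+k′≤m′)) ⟩
    suc k′ * count m n + count (suc m′) n    ≡⟨ cong (λ z → suc k′ * z + count (suc m′) n) (count-large n m m′ 1+k′≤m 1+k′≤m′) ⟩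
    suc k′ * count m′ n + count (suc m′) n   ≡⟨ cong (λ c → c * count m′ n + count (suc m′) n) (choices-large m′ 1+k′≤m′) ⟨
    choices m′ * count m′ n + count (suc m′) n ≡⟨ count-suc m′ n ⟨
    count m′ (suc n)                         ∎
    where open ≡-Reasoning

module PatternAvoidance where

  open Ranges
  open import Data.Nat as ℕ using (ℕ; zero; suc; _≤_; _<_; _∸_; _⊔_; _+_; z≤n; s≤s; _<?_)
  import Data.Nat.Properties as ℕ
  open import Data.List using (List; []; _∷_; map; _++_; length; [_]; upTo; applyUpTo; filter; deduplicate)
  import Data.List.Properties as List
  open import Data.List.Membership.Propositional using (_∈_)
  open import Data.List.Membership.Propositional.Properties
  open import Data.List.Relation.Unary.Any using (here; there)
  open import Data.List.Relation.Unary.All as All using (All; []; _∷_)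
  import Data.List.Relation.Unary.All.Properties as All
  open import Data.List.Relation.Unary.Unique.Propositional using (Unique; []; _∷_)
  import Data.List.Relation.Unary.Unique.Propositional.Properties as Unique
  import Data.List.Relation.Unary.Unique.DecPropositional.Properties as Unique
  open import Data.List.Relation.Binary.Sublist.Propositional using (_⊆_; []; _∷ʳ_; _∷_; minimum; ⊆-refl; ⊆-trans; lookup)
  open import Data.List.Relation.Binary.Sublist.Propositional.Properties using (++⁺ˡ; ++⁺ʳ; ++⁺; map⁺)
  open import Data.Product using (∃₂; _×_; _,_; proj₂)
  open import Data.Sum using (inj₁; inj₂)
  open import Data.Unit using (tt)
  open import Data.Empty using (⊥-elim)
  open import Function using (id; _∘_)
  open import Relation.Binary.PropositionalEquality hiding ([_])
  open import Relation.Nullary using (¬_; ¬?; yes; no)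
  open import Relation.Unary using (Decidable)
  open import Function.Bundles using (mk⇔)

  filter-map : ∀ {P Q : ℕ → Set} (P? : Decidable P) (Q? : Decidable Q) (f : ℕ → ℕ) →
               (∀ {x} → P (f x) → Q x) → (∀ {x} → Q x → P (f x)) →
               ∀ xs → filter P? (map f xs) ≡ map f (filter Q? xs)
  filter-map P? Q? f P⇒Q Q⇒P []       = refl
  filter-map P? Q? f P⇒Q Q⇒P (x ∷ xs) with Q? x
  ... | yes Qx  = trans (List.filter-accept P? (Q⇒P Qx)) (cong (f x ∷_) (filter-map P? Q? f P⇒Q Q⇒P xs))
  ... | no ¬Qx = trans (List.filter-reject P? (¬Qx ∘ P⇒Q)) (filter-map P? Q? f P⇒Q Q⇒P xs)

  deduplicate-map : ∀ (f : ℕ → ℕ) → (∀ {x y} → f x ≡ f y → x ≡ y) →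
                    ∀ xs → deduplicate ℕ._≟_ (map f xs) ≡ map f (deduplicate ℕ._≟_ xs)
  deduplicate-map f f-inj []       = refl
  deduplicate-map f f-inj (x ∷ xs) = cong (f x ∷_) (trans
    (cong (filter (λ y → ¬? (f x ℕ.≟ y))) (deduplicate-map f f-inj xs))
    (filter-map (λ y → ¬? (f x ℕ.≟ y)) (λ y → ¬? (x ℕ.≟ y)) f (λ fx≢fy x≡y → fx≢fy (cong f x≡y))
                (λ x≢y fx≡fy → x≢y (f-inj fx≡fy)) (deduplicate ℕ._≟_ xs)))

  rank : List ℕ → ℕ → ℕ
  rank w a = suc (length (deduplicate ℕ._≟_ (filter (_<? a) w)))

  rank-shift : ∀ c xs a → rank (map (c +_) xs) (c + a) ≡ rank xs a
  rank-shift c xs a = cong suc (begin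
    length (deduplicate ℕ._≟_ (filter (_<? c + a) (map (c +_) xs)))
      ≡⟨ cong (length ∘ deduplicate ℕ._≟_)
              (filter-map (_<? c + a) (_<? a) (c +_) (ℕ.+-cancelˡ-< c _ a) (ℕ.+-monoʳ-< c) xs) ⟩
    length (deduplicate ℕ._≟_ (map (c +_) (filter (_<? a) xs)))
      ≡⟨ cong length (deduplicate-map (c +_) (ℕ.+-cancelˡ-≡ c _ _) (filter (_<? a) xs)) ⟩
    length (map (c +_) (deduplicate ℕ._≟_ (filter (_<? a) xs)))
      ≡⟨ List.length-map (c +_) (deduplicate ℕ._≟_ (filter (_<? a) xs)) ⟩
    length (deduplicate ℕ._≟_ (filter (_<? a) xs)) ∎)
    where open ≡-Reasoning

  reduce-shift : ∀ c xs → reduce (map (c +_) xs) ≡ reduce xs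
  reduce-shift c xs = trans (sym (List.map-∘ xs)) (List.map-cong (rank-shift c xs) xs)

  length-≤-of-⊆ : ∀ {xs ys : List ℕ} → Unique xs → (∀ {x} → x ∈ xs → x ∈ ys) → length xs ≤ length ys
  length-≤-of-⊆ []             _    = z≤n
  length-≤-of-⊆ {x ∷ xs} {ys} (x∉xs ∷ xs!) xs⊆ys with ∈-∃++ (xs⊆ys (here refl))
  ... | pre , post , refl = subst (suc (length xs) ≤_) (sym (List.length-++-sucʳ pre x post))
    (s≤s (length-≤-of-⊆ xs! (λ y∈xs → drop (xs⊆ys (there y∈xs)) (λ y≡x → All.lookup x∉xs y∈xs (sym y≡x)))))
    where
    drop : ∀ {y} → y ∈ pre ++ x ∷ post → ¬ y ≡ x → y ∈ pre ++ post
    drop y∈ y≢x with ∈-++⁻ pre y∈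
    ... | inj₁ y∈pre          = ∈-++⁺ˡ y∈pre
    ... | inj₂ (here y≡x)     = ⊥-elim (y≢x y≡x)
    ... | inj₂ (there y∈post) = ∈-++⁺ʳ pre y∈post

  rank≡1⇒minimal : ∀ σ e → rank σ e ≡ 1 → ∀ {x} → x ∈ σ → e ≤ x
  rank≡1⇒minimal σ e rank≡1 {x} x∈σ with x <? e
  ... | yes x<e = ⊥-elim (ℕ.<-irrefl (sym (ℕ.suc-injective rank≡1))
                    (∈-length (∈-deduplicate⁺ ℕ._≟_ (∈-filter⁺ (_<? e) x∈σ x<e))))
  ... | no x≮e  = ℕ.≮⇒≥ x≮e

  -- Letters of σ below b and not below e lie in the interval [e, b).
  rank≤ : ∀ σ e b → (∀ {x} → x ∈ σ → e ≤ x) → rank σ b ≤ suc (b ∸ e)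
  rank≤ σ e b e≤σ = s≤s (subst (length (deduplicate ℕ._≟_ (filter (_<? b) σ)) ≤_)
    (trans (List.length-map (e +_) (upTo (b ∸ e))) (List.length-upTo (b ∸ e)))
    (length-≤-of-⊆ (Unique.deduplicate-! ℕ._≟_ (filter (_<? b) σ)) in-interval))
    where
    in-interval : ∀ {x} → x ∈ deduplicate ℕ._≟_ (filter (_<? b) σ) → x ∈ map (e +_) (upTo (b ∸ e))
    in-interval {x} x∈ with ∈-filter⁻ (_<? b) (∈-deduplicate⁻ ℕ._≟_ (filter (_<? b) σ) x∈)
    ... | x∈σ , x<b = subst (_∈ map (e +_) (upTo (b ∸ e))) (ℕ.m+[n∸m]≡n (e≤σ x∈σ))
                        (∈-map⁺ (e +_) (∈-upTo⁺ (ℕ.∸-monoˡ-< x<b (e≤σ x∈σ))))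

  applyUpTo-⊆ : ∀ (f : ℕ → ℕ) a n m → a + n ≤ m → applyUpTo (λ i → f (a + i)) n ⊆ applyUpTo f m
  applyUpTo-⊆ f zero    zero    m       _         = minimum _
  applyUpTo-⊆ f zero    (suc n) (suc m) (s≤s n≤m) = refl ∷ applyUpTo-⊆ (f ∘ suc) zero n m n≤m
  applyUpTo-⊆ f (suc a) n       (suc m) (s≤s a+n≤m) = f 0 ∷ʳ applyUpTo-⊆ (f ∘ suc) a n m a+n≤m

  map-≡-++-∷-∷ : ∀ (f : ℕ → ℕ) xs ys u v → map f xs ≡ ys ++ u ∷ v ∷ [] →
                 ∃₂ λ xs′ b → ∃₂ λ e (_ : xs ≡ xs′ ++ b ∷ e ∷ []) → f b ≡ u × f e ≡ v
  map-≡-++-∷-∷ f (b ∷ e ∷ []) []       u v refl = [] , b , e , refl , refl , refl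
  map-≡-++-∷-∷ f (x ∷ xs)     (y ∷ ys) u v eq with map-≡-++-∷-∷ f xs ys u v (proj₂ (List.∷-injective eq))
  ... | xs′ , b , e , refl , fb≡u , fe≡v = x ∷ xs′ , b , e , refl , fb≡u , fe≡v

  module Characterisation (k′ : ℕ) where

    open Enumeration k′

    admissible⇒RG : ∀ m w → Admissible m w → RG m w
    admissible⇒RG m []      _                       = tt
    admissible⇒RG m (a ∷ w) (1≤a , a≤1+m , _ , adm) = 1≤a , a≤1+m , admissible⇒RG (m ⊔ a) w adm

    admissible-∈ : ∀ m w {e} → Admissible m w → e ∈ w → m ≤ e + k′
    admissible-∈ m (a ∷ w) (_ , _ , m≤a+k′ , _)   (here refl) = m≤a+k′
    admissible-∈ m (a ∷ w) (_ , _ , _      , adm) (there e∈w) =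
      ℕ.≤-trans (ℕ.m≤m⊔n m a) (admissible-∈ (m ⊔ a) w adm e∈w)

    admissible-pair : ∀ m w {b e} → Admissible m w → b ∷ e ∷ [] ⊆ w → b ≤ e + k′
    admissible-pair m (a ∷ w) (_ , _ , _ , adm) (.a ∷ʳ be⊆w) = admissible-pair (m ⊔ a) w adm be⊆w
    admissible-pair m (a ∷ w) (_ , _ , _ , adm) (refl ∷ e⊆w) =
      ℕ.≤-trans (ℕ.m≤n⊔m m a) (admissible-∈ (m ⊔ a) w adm (lookup e⊆w (here refl)))

    τ : List ℕ
    τ = pattern-k1 (suc (suc k′))

    τ-split : τ ≡ map suc (upTo (suc k′)) ++ suc (suc k′) ∷ 1 ∷ []
    τ-split = begin
      map suc (upTo (suc (suc k′))) ++ [ 1 ]                 ≡⟨ cong (λ l → map suc l ++ [ 1 ]) (List.upTo-∷ʳ (suc k′)) ⟨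
      map suc (upTo (suc k′) ++ [ suc k′ ]) ++ [ 1 ]         ≡⟨ cong (_++ [ 1 ]) (List.map-++ suc (upTo (suc k′)) [ suc k′ ]) ⟩
      (map suc (upTo (suc k′)) ++ [ suc (suc k′) ]) ++ [ 1 ] ≡⟨ List.++-assoc (map suc (upTo (suc k′))) _ _ ⟩
      map suc (upTo (suc k′)) ++ suc (suc k′) ∷ 1 ∷ []       ∎
      where open ≡-Reasoning

    rank-τ-1 : rank τ 1 ≡ 1
    rank-τ-1 = cong (λ l → suc (length (deduplicate ℕ._≟_ l))) (List.filter-none (_<? 1) positive)
      where
      positive : All (λ x → ¬ x < 1) τ
      positive = All.++⁺ (All.map⁺ (All.applyUpTo⁺₂ id (suc (suc k′)) (λ _ → λ { (s≤s ()) })))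
                         ((λ { (s≤s ()) }) ∷ [])

    rank-τ-k : suc (suc k′) ≤ rank τ (suc (suc k′))
    rank-τ-k = s≤s (subst (_≤ length (deduplicate ℕ._≟_ (filter (_<? suc (suc k′)) τ)))
      (trans (List.length-map suc (upTo (suc k′))) (List.length-upTo (suc k′)))
      (length-≤-of-⊆ (Unique.map⁺ ℕ.suc-injective (Unique.applyUpTo⁺₁ id (suc k′) (λ i<j _ → ℕ.<⇒≢ i<j)))
                     below))
      where
      below : ∀ {x} → x ∈ map suc (upTo (suc k′)) → x ∈ deduplicate ℕ._≟_ (filter (_<? suc (suc k′)) τ)
      below x∈ with ∈-map⁻ suc x∈
      ... | i , i∈ , refl = ∈-deduplicate⁺ ℕ._≟_ (∈-filter⁺ (_<? suc (suc k′))
              (∈-++⁺ˡ (∈-map⁺ suc (∈-upTo⁺ (ℕ.m<n⇒m<1+n (∈-upTo⁻ i∈))))) (s≤s (∈-upTo⁻ i∈)))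

    reduce-τ : reduce τ ≡ map (rank τ) (map suc (upTo (suc k′))) ++ rank τ (suc (suc k′)) ∷ rank τ 1 ∷ []
    reduce-τ = trans (cong (map (rank τ)) τ-split) (List.map-++ (rank τ) (map suc (upTo (suc k′))) _)

    -- In an occurrence σ′ b e of τ, e is the least letter and k′ + 1 distinct letters of σ′ lie in
    -- [e, b), so b ≥ e + k′ + 1; admissibility gives b ≤ e + k′.
    avoids-of-admissible : ∀ π → Admissible 0 π → Avoids π τ
    avoids-of-admissible π adm (σ , σ⊆π , reduceσ≡reduceτ)
      with map-≡-++-∷-∷ (rank σ) σ (map (rank τ) (map suc (upTo (suc k′)))) (rank τ (suc (suc k′))) (rank τ 1)
                        (trans reduceσ≡reduceτ reduce-τ)
    ... | σ′ , b , e , refl , rank-b , rank-e = ℕ.<-irrefl refl (ℕ.≤-trans far near)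
      where
      e≤σ : ∀ {x} → x ∈ σ′ ++ b ∷ e ∷ [] → e ≤ x
      e≤σ = rank≡1⇒minimal _ e (trans rank-e rank-τ-1)
      1+k′≤b∸e : suc k′ ≤ b ∸ e
      1+k′≤b∸e = ℕ.≤-pred (ℕ.≤-trans rank-τ-k (subst (_≤ suc (b ∸ e)) rank-b (rank≤ _ e b e≤σ)))
      far : suc k′ + e ≤ b
      far = ℕ.m≤o∸n⇒m+n≤o (suc k′) (e≤σ (∈-++⁺ʳ σ′ (here refl))) 1+k′≤b∸e
      near : b ≤ k′ + e
      near = subst (b ≤_) (ℕ.+-comm e k′) (admissible-pair 0 π adm (⊆-trans (++⁺ˡ σ′ ⊆-refl) σ⊆π))

    -- The prefix p contains 1 2 ⋯ m as a subsequence; a letter a with a + k′ < m then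
    -- closes the shifted copy a (a+1) ⋯ (a+k′+1) a of τ.
    admissible-of-avoids : ∀ w m p → map suc (upTo m) ⊆ p → RG m w → Avoids (p ++ w) τ → Admissible m w
    admissible-of-avoids []            m p _   _                        _   = tt
    admissible-of-avoids (suc a′ ∷ w) m p 1…m⊆p (1≤a , a≤1+m , rg) avoids with m ℕ.≤? suc a′ + k′
    ... | yes m≤a+k′ = 1≤a , a≤1+m , m≤a+k′ ,
      admissible-of-avoids w (m ⊔ a) (p ++ [ a ]) 1…m⊔a⊆p∷a rg
        (subst (λ z → Avoids z τ) (sym (List.++-assoc p [ a ] w)) avoids)
      where
      a = suc a′
      1…m⊔a⊆p∷a : map suc (upTo (m ⊔ a)) ⊆ p ++ [ a ]
      1…m⊔a⊆p∷a with ℕ.m≤n⇒m<n∨m≡n a≤1+m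
      ... | inj₁ a≤m = subst (λ z → map suc (upTo z) ⊆ p ++ [ a ]) (sym (ℕ.m≥n⇒m⊔n≡m (ℕ.≤-pred a≤m)))
                             (++⁺ʳ [ a ] 1…m⊆p)
      ... | inj₂ refl = subst (λ z → map suc (upTo z) ⊆ p ++ [ a ]) (sym (ℕ.m≤n⇒m⊔n≡n (ℕ.n≤1+n m)))
                              (subst (_⊆ p ++ [ a ]) (sym 1…1+m) (++⁺ 1…m⊆p (refl ∷ [])))
        where
        1…1+m : map suc (upTo (suc m)) ≡ map suc (upTo m) ++ [ suc m ]
        1…1+m = trans (cong (map suc) (sym (List.upTo-∷ʳ m))) (List.map-++ suc (upTo m) [ m ])
    ... | no m≰a+k′ = ⊥-elim (avoids (map (a′ +_) τ , shifted-τ⊆ , reduce-shift a′ τ))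
      where
      a = suc a′
      k = suc (suc k′)
      a′+k≤m : a′ + k ≤ m
      a′+k≤m = subst (_≤ m) (sym (trans (ℕ.+-suc a′ (suc k′)) (cong suc (ℕ.+-suc a′ k′)))) (ℕ.≰⇒> m≰a+k′)
      block : map (a′ +_) (map suc (upTo k)) ⊆ p
      block = subst (_⊆ p) shifted (⊆-trans (map⁺ suc (subst (_⊆ upTo m) (sym (List.map-upTo (a′ +_) k))
                                                            (applyUpTo-⊆ id a′ k m a′+k≤m))) 1…m⊆p)
        where
        shifted : map suc (map (a′ +_) (upTo k)) ≡ map (a′ +_) (map suc (upTo k))
        shifted = trans (sym (List.map-∘ (upTo k)))
                    (trans (List.map-cong (λ i → sym (ℕ.+-suc a′ i)) (upTo k)) (List.map-∘ (upTo k)))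
      shifted-τ⊆ : map (a′ +_) τ ⊆ p ++ a ∷ w
      shifted-τ⊆ = subst (_⊆ p ++ a ∷ w) (sym (List.map-++ (a′ +_) (map suc (upTo k)) [ 1 ]))
                     (++⁺ block (trans (ℕ.+-suc a′ 0) (cong suc (ℕ.+-identityʳ a′)) ∷ minimum w))

    admissible-of-partition : ∀ π → RG 0 π → Avoids π τ → Admissible 0 π
    admissible-of-partition π = admissible-of-avoids π 0 [] []

    noncrossing-hasCard : ∀ n → HasCard (Noncrossing-k1 (suc (suc k′)) n) (count 0 n)
    noncrossing-hasCard n = words 0 n , words-unique 0 n , (λ w → mk⇔ (sound w) (complete w)) , refl
      where
      sound : ∀ w → w ∈ words 0 n → Noncrossing-k1 (suc (suc k′)) n w
      sound w w∈ with ∈-words⁻ 0 n w∈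
      ... | |w|≡n , adm = (|w|≡n , admissible⇒RG 0 w adm) , avoids-of-admissible w adm
      complete : ∀ w → Noncrossing-k1 (suc (suc k′)) n w → w ∈ words 0 n
      complete w ((|w|≡n , rg) , avoids) = ∈-words⁺ 0 n w |w|≡n (admissible-of-partition w rg avoids)

open GeneratingFunction using (G₀-⊛-Den)
open PatternAvoidance using (module Characterisation)
open import Data.Nat as ℕ using (suc; _≤_; z≤n; s≤s)
import Data.Nat.Properties as ℕ
open import Data.Integer as ℤ using (+_)
import Data.Integer.Properties as ℤ
open import Data.Product using (_,_)
open import Relation.Binary.PropositionalEquality using (refl; cong; module ≡-Reasoning)

theorem2 : (k : ℕ) → k ≥ 2 →
    Σ (ℕ → ℕ) λ a →
      ((n : ℕ) → HasCard (Noncrossing-k1 k n) (a n)) ×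
      ((n : ℕ) → seriesTimes a (Den k) n ≡ coeff (Num k) n)
theorem2 (suc (suc k′)) (s≤s (s≤s z≤n)) =
  count 0 , noncrossing-hasCard , G₀-⊛-Den k′ (λ m n → + count m n) (λ _ → refl) count-suc-ℤ count-top
  where
  open Enumeration k′
  open Characterisation k′
  count-suc-ℤ : ∀ m n → m ≤ suc k′ → + count m (suc n) ≡ + m ℤ.* + count m n ℤ.+ + count (suc m) n
  count-suc-ℤ m n m≤1+k′ = begin
    + count m (suc n)                                 ≡⟨ cong +_ (count-suc m n) ⟩
    + (choices m ℕ.* count m n ℕ.+ count (suc m) n)   ≡⟨ cong (λ c → + (c ℕ.* count m n ℕ.+ count (suc m) n))
                                                              (choices-small m m≤1+k′) ⟩
    + (m ℕ.* count m n ℕ.+ count (suc m) n)           ≡⟨ ℤ.pos-+ (m ℕ.* count m n) (count (suc m) n) ⟩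
    + (m ℕ.* count m n) ℤ.+ + count (suc m) n         ≡⟨ cong (ℤ._+ + count (suc m) n) (ℤ.pos-* m (count m n)) ⟩
    + m ℤ.* + count m n ℤ.+ + count (suc m) n         ∎
    where open ≡-Reasoning
  count-top : ∀ n → + count (suc (suc k′)) n ≡ + count (suc k′) n
  count-top n = cong +_ (count-large n (suc (suc k′)) (suc k′) (ℕ.n≤1+n (suc k′)) ℕ.≤-refl)
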